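{- $(\mathbf{W},\nabla_{\mathrm{sh}},\iota,\Delta_\odot,\epsilon_\odot)$ is a graded bialgebra, but it is not a Hopf algebra.
   Context: Fix a field $\mathbb{k}$. A word is a finite sequence of positive integers; $\max(w)$ is its largest letter ($\max(\emptyset)=0$) and $\ell(w)$ its length. For words $u$ (length $a$) and $v$ (length $b$), $\operatorname{sh}(u,v)=\sum_{I\subseteq\{1,\dots,a+b\},|I|=a}x_I$ (formal sum with multiplicity) where $x_I$ is the word whose letters at positions in $I$ spell $u$ and at positions in the complement spell $v$. For a word $w$, $w\uparrow m$ adds $m$ to each letter. $\mathbf{W}$ is the $\mathbb{k}$-vector space with basis the symbols $[w,n]$, where $n\in\mathbb{N}$ and $w$ is a word with $\max(w)\le n$; $[w,n]$ has degree $\ell(w)$. The product is $\nabla_{\mathrm{sh}}([v,m]\otimes[w,n])=\sum_{u\in\operatorname{sh}(v,w\uparrow m)}[u,m+n]$, the unit is $\iota(1)=[\emptyset,0]$, the coproduct is $\Delta_\odot([w_1\cdots w_k,n])=\sum_{i=0}^k[w_1\cdots w_i,n]\otimes[w_{i+1}\cdots w_k,n]$, and the counit is $\epsilon_\odot([w,n])=1$ if $w=\emptyset$ and $0$ otherwise. -}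

module Defs where

open import Level using (Level; _⊔_) renaming (suc to lsuc)
open import Algebra.Bundles using (CommutativeRing)
open import Data.Bool using (Bool; true; false; if_then_else_)
open import Data.Nat using (ℕ; zero; suc)
import Data.Nat as ℕ
open import Data.Fin using (Fin; _↑ˡ_; _↑ʳ_)
import Data.Fin as Fin
open import Data.List using (List; []; _∷_; [_]; map; _++_; concatMap; filter; length; take; drop; upTo; foldr)
import Data.List.Properties as ListP
open import Data.Vec using (Vec; []; _∷_)
open import Data.Product using (Σ; _×_; _,_; proj₁; proj₂)
import Data.Product.Properties as ProdP
open import Relation.Nullary using (¬_; does)
open import Relation.Binary.PropositionalEquality using (_≡_)
open import Relation.Binary.Definitions using (DecidableEquality)

record Field (c ℓ : Level) : Set (lsuc (c ⊔ ℓ)) where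
  field
    commutativeRing : CommutativeRing c ℓ
  open CommutativeRing commutativeRing public
  field
    1≉0     : ¬ (1# ≈ 0#)
    inverse : ∀ x → ¬ (x ≈ 0#) → Σ Carrier (λ y → x * y ≈ 1#)

-- Shuffles, following the paper: sh(u,v) = Σ_{I ⊆ {1..a+b}, |I| = a} x_I.
-- A subset I of {1,…,k} is a Vec Bool k (true at position i iff i ∈ I).

allSubsets : (k : ℕ) → List (Vec Bool k)
allSubsets zero    = [ [] ]
allSubsets (suc k) = map (true ∷_) (allSubsets k) ++ map (false ∷_) (allSubsets k)

card : ∀ {k} → Vec Bool k → ℕ
card []           = 0
card (true  ∷ I)  = suc (card I)
card (false ∷ I)  = card I

-- x_I : letters at positions in I spell u, at the other positions spell v
-- (only used when |I| = length u and k = length u + length v).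
interleave : ∀ {A : Set} {k} → Vec Bool k → List A → List A → List A
interleave []          u       v       = []
interleave (true  ∷ I) (x ∷ u) v       = x ∷ interleave I u v
interleave (true  ∷ I) []      v       = []
interleave (false ∷ I) u       (y ∷ v) = y ∷ interleave I u v
interleave (false ∷ I) u       []      = []

sh : ∀ {A : Set} → List A → List A → List (List A)
sh u v = map (λ I → interleave I u v)
             (filter (λ I → card I ℕ.≟ length u) (allSubsets (length u ℕ.+ length v)))

-- Basis of W: symbols [w,n] with n ∈ ℕ and w a word with max(w) ≤ n.
-- A word with letters in {1,…,n} is a List (Fin n); the letter i : Fin n
-- stands for the positive integer toℕ i + 1.  Then w ↑ m is  map (m ↑ʳ_),
-- and a word v with max(v) ≤ m, viewed with bound m+n, is map (_↑ˡ n) v.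

Basis : Set
Basis = Σ ℕ (λ n → List (Fin n))

deg : Basis → ℕ
deg (n , w) = length w

_≟B_ : DecidableEquality Basis
_≟B_ = ProdP.≡-dec ℕ._≟_ (ListP.≡-dec Fin._≟_)

_≟B2_ : DecidableEquality (Basis × Basis)
_≟B2_ = ProdP.≡-dec _≟B_ _≟B_

_≟B3_ : DecidableEquality (Basis × (Basis × Basis))
_≟B3_ = ProdP.≡-dec _≟B_ _≟B2_

-- Vector spaces with a given basis over a field, as finite formal sums
-- (lists of coefficient/basis-element pairs); two formal sums are equal
-- in the space iff all their coefficients agree.

module Linear {c ℓ} (F : Field c ℓ) where
  open Field F

  FS : Set → Set c
  FS X = List (Carrier × X)

  coeff : ∀ {X : Set} → DecidableEquality X → FS X → X → Carrier
  coeff d []             x = 0#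
  coeff d ((a , y) ∷ xs) x = if does (d y x) then a + coeff d xs x else coeff d xs x

  _≈⟨_⟩_ : ∀ {X : Set} → FS X → DecidableEquality X → FS X → Set ℓ
  xs ≈⟨ d ⟩ ys = ∀ x → coeff d xs x ≈ coeff d ys x

  η : ∀ {X : Set} → X → FS X
  η x = [ (1# , x) ]

  scale : ∀ {X : Set} → Carrier → FS X → FS X
  scale a = map (λ p → (a * proj₁ p , proj₂ p))

  lin : ∀ {X Y : Set} → (X → FS Y) → FS X → FS Y
  lin f = concatMap (λ p → scale (proj₁ p) (f (proj₂ p)))

  _⊗ₑ_ : ∀ {X Y : Set} → FS X → FS Y → FS (X × Y)
  xs ⊗ₑ ys = concatMap (λ p → map (λ q → (proj₁ p * proj₁ q , (proj₂ p , proj₂ q))) ys) xs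

  _⊗ₘ_ : ∀ {X X' Y Y' : Set} → (FS X → FS X') → (FS Y → FS Y') → FS (X × Y) → FS (X' × Y')
  (f ⊗ₘ g) = lin (λ p → f (η (proj₁ p)) ⊗ₑ g (η (proj₂ p)))

  idₘ : ∀ {X : Set} → FS X → FS X
  idₘ xs = xs

  assocₘ : ∀ {X Y Z : Set} → FS ((X × Y) × Z) → FS (X × (Y × Z))
  assocₘ = map (λ p → (proj₁ p , (proj₁ (proj₁ (proj₂ p)) , (proj₂ (proj₁ (proj₂ p)) , proj₂ (proj₂ p)))))

  midSwap : ∀ {A B C D : Set} → FS ((A × B) × (C × D)) → FS ((A × C) × (B × D))
  midSwap = map (λ p → (proj₁ p ,
    ((proj₁ (proj₁ (proj₂ p)) , proj₁ (proj₂ (proj₂ p))) ,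
     (proj₂ (proj₁ (proj₂ p)) , proj₂ (proj₂ (proj₂ p))))))

module WordAlgebra {c ℓ} (F : Field c ℓ) where
  open Field F
  open Linear F public

  W : Set c
  W = FS Basis

  mulB : Basis → Basis → W
  mulB (m , v) (n , w) =
    map (λ u → (1# , (m ℕ.+ n , u))) (sh (map (_↑ˡ n) v) (map (m ↑ʳ_) w))

  ∇sh : FS (Basis × Basis) → W
  ∇sh = lin (λ p → mulB (proj₁ p) (proj₂ p))

  ι : Carrier → W
  ι a = [ (a , (0 , [])) ]

  comulB : Basis → FS (Basis × Basis)
  comulB (n , w) = map (λ i → (1# , ((n , take i w) , (n , drop i w)))) (upTo (suc (length w)))

  Δ⊙ : W → FS (Basis × Basis)
  Δ⊙ = lin comulB

  εB : Basis → Carrier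
  εB (n , [])    = 1#
  εB (n , _ ∷ _) = 0#

  ε⊙ : W → Carrier
  ε⊙ = foldr (λ p acc → proj₁ p * εB (proj₂ p) + acc) 0#

  _≈W_ : W → W → Set ℓ
  x ≈W y = x ≈⟨ _≟B_ ⟩ y

  _≈W²_ : FS (Basis × Basis) → FS (Basis × Basis) → Set ℓ
  x ≈W² y = x ≈⟨ _≟B2_ ⟩ y

  _≈W³_ : FS (Basis × (Basis × Basis)) → FS (Basis × (Basis × Basis)) → Set ℓ
  x ≈W³ y = x ≈⟨ _≟B3_ ⟩ y

  -- Identities of linear maps are stated on (tensors of) basis elements,
  -- which determine the maps by linearity.
  record IsGradedBialgebra : Set (c ⊔ ℓ) where
    field
      assoc    : ∀ a b d → ∇sh (∇sh (η a ⊗ₑ η b) ⊗ₑ η d) ≈W ∇sh (η a ⊗ₑ ∇sh (η b ⊗ₑ η d))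
      unitˡ    : ∀ b → ∇sh (ι 1# ⊗ₑ η b) ≈W η b
      unitʳ    : ∀ b → ∇sh (η b ⊗ₑ ι 1#) ≈W η b
      coassoc  : ∀ b → assocₘ ((Δ⊙ ⊗ₘ idₘ) (Δ⊙ (η b))) ≈W³ (idₘ ⊗ₘ Δ⊙) (Δ⊙ (η b))
      counitˡ  : ∀ b → lin (λ p → scale (ε⊙ (η (proj₁ p))) (η (proj₂ p))) (Δ⊙ (η b)) ≈W η b
      counitʳ  : ∀ b → lin (λ p → scale (ε⊙ (η (proj₂ p))) (η (proj₁ p))) (Δ⊙ (η b)) ≈W η b
      Δ-∇      : ∀ a b → Δ⊙ (∇sh (η a ⊗ₑ η b))
                           ≈W² (∇sh ⊗ₘ ∇sh) (midSwap (Δ⊙ (η a) ⊗ₑ Δ⊙ (η b)))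
      Δ-ι      : Δ⊙ (ι 1#) ≈W² (ι 1# ⊗ₑ ι 1#)
      ε-∇      : ∀ a b → ε⊙ (∇sh (η a ⊗ₑ η b)) ≈ ε⊙ (η a) * ε⊙ (η b)
      ε-ι      : ε⊙ (ι 1#) ≈ 1#
      ∇-graded : ∀ a b u → ¬ (deg u ≡ deg a ℕ.+ deg b) → coeff _≟B_ (∇sh (η a ⊗ₑ η b)) u ≈ 0#
      ι-graded : ∀ u → ¬ (deg u ≡ 0) → coeff _≟B_ (ι 1#) u ≈ 0#
      Δ-graded : ∀ a u v → ¬ (deg u ℕ.+ deg v ≡ deg a) → coeff _≟B2_ (Δ⊙ (η a)) (u , v) ≈ 0#
      ε-graded : ∀ a → ¬ (deg a ≡ 0) → ε⊙ (η a) ≈ 0#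

  IsAntipode : (Basis → W) → Set ℓ
  IsAntipode S =
    (∀ b → ∇sh ((lin S ⊗ₘ idₘ) (Δ⊙ (η b))) ≈W ι (ε⊙ (η b))) ×
    (∀ b → ∇sh ((idₘ ⊗ₘ lin S) (Δ⊙ (η b))) ≈W ι (ε⊙ (η b)))

  IsHopfAlgebra : Set (c ⊔ ℓ)
  IsHopfAlgebra = IsGradedBialgebra × Σ (Basis → W) IsAntipode

module Submission where

-- On basis elements ∇_sh is the sum of the shuffles of two words and Δ_⊙ the sum of the
-- deconcatenations of one word, all with coefficient 1.  Each bialgebra axiom therefore amounts
-- to two lists of basis elements being permutations of each other: associativity of shuffling,
-- coassociativity of deconcatenation, and the fact that the deconcatenations of the shuffles of
-- u and v are the componentwise shuffles of the deconcatenations of u and v.  All three follow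
-- by induction, sorting both sides by the first letter.
-- The index n of [w,n] adds up under ∇_sh.  An antipode S would give
-- ∇_sh(S[∅,1] ⊗ [∅,1]) = ∇_sh(S ⊗ id)Δ_⊙[∅,1] = ι ε_⊙[∅,1] = [∅,0],
-- but every product with [∅,1] as right factor has index at least 1.

open import Defs
open import Level using (_⊔_)
open import Algebra.Bundles using (CommutativeMonoid)
import Algebra.Properties.CommutativeSemigroup as CommutativeSemigroupProperties
open import Data.Bool using (Bool; true; false)
open import Data.Empty using (⊥-elim)
open import Data.Fin using (Fin; _↑ˡ_; _↑ʳ_; toℕ)
import Data.Fin.Properties as Fin
open import Data.List
  using (List; []; _∷_; [_]; map; _++_; concatMap; filter; length; take; drop; upTo; applyUpTo; foldr; cartesianProduct)
open import Data.List.Properties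
open import Data.Product.Properties using () renaming (≡-dec to ×-≡-dec)
import Data.List.Relation.Binary.Permutation.Propositional as ↭
open ↭ using (_↭_; ↭-refl; ↭-prep; ↭-sym; ↭-trans; ↭-reflexive; module PermutationReasoning)
open import Data.List.Relation.Binary.Permutation.Propositional.Properties
  using (++⁺; ++⁺ˡ; ++-commutativeMonoid) renaming (map⁺ to map⁺-↭)
open import Data.List.Relation.Unary.All as All using (All; []; _∷_)
open import Data.List.Relation.Unary.All.Properties
  using () renaming (map⁺ to All-map⁺; ++⁺ to All-++⁺; concat⁺ to All-concat⁺)
open import Data.Nat using (ℕ; zero; suc; _≟_)
import Data.Nat as ℕ
import Data.Nat.Properties as ℕ
open import Data.Product using (∃-syntax; _×_; _,_; proj₁; proj₂; map₁; map₂)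
import Data.Product as Product
open import Data.Vec using (Vec) renaming (_∷_ to _∷ᵛ_)
open import Function using (_∘_; id)
open import Function.Definitions using (Injective)
open import Relation.Binary.PropositionalEquality using (_≡_; _≢_; refl; sym; trans; cong; cong₂; subst; module ≡-Reasoning)
open import Relation.Nullary using (¬_; Dec; does; yes; no)
open import Relation.Binary.Definitions using (DecidableEquality)

private variable
  A B C D : Set

-- Lists up to permutation

↭-interchange : (as bs cs ds : List A) → (as ++ bs) ++ (cs ++ ds) ↭ (as ++ cs) ++ (bs ++ ds)
↭-interchange {A} = interchange
  where open CommutativeSemigroupProperties (CommutativeMonoid.commutativeSemigroup (++-commutativeMonoid {A = A}))

map∘map-cong : ∀ {a b c d} {A : Set a} {B : Set b} {C : Set c} {D : Set d}
               {f : A → B} {g : B → C} {f′ : A → D} {g′ : D → C} →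
               (∀ x → g (f x) ≡ g′ (f′ x)) → ∀ xs → map g (map f xs) ≡ map g′ (map f′ xs)
map∘map-cong eq xs = trans (sym (map-∘ xs)) (trans (map-cong eq xs) (map-∘ xs))

concatMap-↭ : {f g : A → List B} → (∀ x → f x ↭ g x) → ∀ xs → concatMap f xs ↭ concatMap g xs
concatMap-↭ f↭g []       = ↭-refl
concatMap-↭ f↭g (x ∷ xs) = ++⁺ (f↭g x) (concatMap-↭ f↭g xs)

concatMap-++-↭ : (f g : A → List B) (xs : List A) →
                 concatMap (λ x → f x ++ g x) xs ↭ concatMap f xs ++ concatMap g xs
concatMap-++-↭ f g []       = ↭-refl
concatMap-++-↭ f g (x ∷ xs) =
  ↭-trans (++⁺ˡ (f x ++ g x) (concatMap-++-↭ f g xs)) (↭-interchange (f x) (g x) _ _)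

concatMap-map-++-↭ : (h k : B → C) (f g : A → List B) (xs : List A) →
                     concatMap (λ x → map h (f x) ++ map k (g x)) xs
                       ↭ map h (concatMap f xs) ++ map k (concatMap g xs)
concatMap-map-++-↭ h k f g xs = ↭-trans (concatMap-++-↭ (map h ∘ f) (map k ∘ g) xs)
  (↭-reflexive (sym (cong₂ _++_ (map-concatMap h f xs) (map-concatMap k g xs))))

concatMap-∷-↭ : (f : A → B) (g : A → List B) (xs : List A) →
                concatMap (λ x → f x ∷ g x) xs ↭ map f xs ++ concatMap g xs
concatMap-∷-↭ f g xs = ↭-trans (concatMap-++-↭ ([_] ∘ f) g xs)
  (↭-reflexive (cong (_++ concatMap g xs) (trans (sym (concatMap-map [_] f xs)) (concatMap-pure (map f xs)))))

-- Shuffles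

infix 6 _⧢_

_⧢_ : List A → List A → List (List A)
[]      ⧢ v       = [ v ]
(x ∷ u) ⧢ []      = [ x ∷ u ]
(x ∷ u) ⧢ (y ∷ v) = map (x ∷_) (u ⧢ (y ∷ v)) ++ map (y ∷_) ((x ∷ u) ⧢ v)

⧢-identityʳ : (u : List A) → u ⧢ [] ≡ [ u ]
⧢-identityʳ []      = refl
⧢-identityʳ (x ∷ u) = refl

map-⧢ : (f : A → B) (u v : List A) → map (map f) (u ⧢ v) ≡ map f u ⧢ map f v
map-⧢ f []      v       = refl
map-⧢ f (x ∷ u) []      = refl
map-⧢ f (x ∷ u) (y ∷ v) = begin
    map (map f) (map (x ∷_) (u ⧢ (y ∷ v)) ++ map (y ∷_) ((x ∷ u) ⧢ v))
  ≡⟨ map-++ (map f) (map (x ∷_) (u ⧢ (y ∷ v))) (map (y ∷_) ((x ∷ u) ⧢ v)) ⟩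
    map (map f) (map (x ∷_) (u ⧢ (y ∷ v))) ++ map (map f) (map (y ∷_) ((x ∷ u) ⧢ v))
  ≡⟨ cong₂ _++_ (map∘map-cong (λ _ → refl) (u ⧢ (y ∷ v))) (map∘map-cong (λ _ → refl) ((x ∷ u) ⧢ v)) ⟩
    map (f x ∷_) (map (map f) (u ⧢ (y ∷ v))) ++ map (f y ∷_) (map (map f) ((x ∷ u) ⧢ v))
  ≡⟨ cong₂ (λ s t → map (f x ∷_) s ++ map (f y ∷_) t) (map-⧢ f u (y ∷ v)) (map-⧢ f (x ∷ u) v) ⟩
    map f (x ∷ u) ⧢ map f (y ∷ v) ∎
  where open ≡-Reasoning

⧢-length : (u v : List A) → All (λ s → length s ≡ length u ℕ.+ length v) (u ⧢ v)
⧢-length []      v       = refl ∷ []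
⧢-length (x ∷ u) []      = cong suc (sym (ℕ.+-identityʳ (length u))) ∷ []
⧢-length (x ∷ u) (y ∷ v) = All-++⁺
  (All-map⁺ (All.map (cong suc) (⧢-length u (y ∷ v))))
  (All-map⁺ (All.map (λ e → cong suc (trans e (sym (ℕ.+-suc (length u) (length v))))) (⧢-length (x ∷ u) v)))

concatMap-⧢-prefixˡ : (a z : A) (Z : List A) (S : List (List A)) →
                     concatMap (_⧢ (z ∷ Z)) (map (a ∷_) S)
                       ↭ map (a ∷_) (concatMap (_⧢ (z ∷ Z)) S) ++ map (z ∷_) (concatMap (_⧢ Z) (map (a ∷_) S))
concatMap-⧢-prefixˡ a z Z S = ↭-trans (↭-reflexive (concatMap-map (_⧢ (z ∷ Z)) (a ∷_) S))
  (↭-trans (concatMap-map-++-↭ (a ∷_) (z ∷_) (_⧢ (z ∷ Z)) (λ u → (a ∷ u) ⧢ Z) S)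
           (↭-reflexive (cong (λ t → map (a ∷_) (concatMap (_⧢ (z ∷ Z)) S) ++ map (z ∷_) t)
                              (sym (concatMap-map (_⧢ Z) (a ∷_) S)))))

concatMap-⧢-prefixʳ : (x b : A) (X : List A) (T : List (List A)) →
                     concatMap ((x ∷ X) ⧢_) (map (b ∷_) T)
                       ↭ map (x ∷_) (concatMap (X ⧢_) (map (b ∷_) T)) ++ map (b ∷_) (concatMap ((x ∷ X) ⧢_) T)
concatMap-⧢-prefixʳ x b X T = ↭-trans (↭-reflexive (concatMap-map ((x ∷ X) ⧢_) (b ∷_) T))
  (↭-trans (concatMap-map-++-↭ (x ∷_) (b ∷_) (λ w → X ⧢ (b ∷ w)) ((x ∷ X) ⧢_) T)
           (↭-reflexive (cong (λ t → map (x ∷_) t ++ map (b ∷_) (concatMap ((x ∷ X) ⧢_) T))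
                              (sym (concatMap-map (X ⧢_) (b ∷_) T)))))

⧢-assoc-unfoldˡ : (x y z : A) (X Y Z : List A) →
                  concatMap (_⧢ (z ∷ Z)) ((x ∷ X) ⧢ (y ∷ Y))
                    ↭ (map (x ∷_) (concatMap (_⧢ (z ∷ Z)) (X ⧢ (y ∷ Y)))
                         ++ map (y ∷_) (concatMap (_⧢ (z ∷ Z)) ((x ∷ X) ⧢ Y)))
                      ++ map (z ∷_) (concatMap (_⧢ Z) ((x ∷ X) ⧢ (y ∷ Y)))
⧢-assoc-unfoldˡ x y z X Y Z = begin
    concatMap (_⧢ (z ∷ Z)) (map (x ∷_) S₁ ++ map (y ∷_) S₂)
  ≡⟨ concatMap-++ (_⧢ (z ∷ Z)) (map (x ∷_) S₁) (map (y ∷_) S₂) ⟩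
    concatMap (_⧢ (z ∷ Z)) (map (x ∷_) S₁) ++ concatMap (_⧢ (z ∷ Z)) (map (y ∷_) S₂)
  ↭⟨ ++⁺ (concatMap-⧢-prefixˡ x z Z S₁) (concatMap-⧢-prefixˡ y z Z S₂) ⟩
    (map (x ∷_) L₁ ++ map (z ∷_) L₁′) ++ (map (y ∷_) L₂ ++ map (z ∷_) L₂′)
  ↭⟨ ↭-interchange (map (x ∷_) L₁) (map (z ∷_) L₁′) (map (y ∷_) L₂) (map (z ∷_) L₂′) ⟩
    (map (x ∷_) L₁ ++ map (y ∷_) L₂) ++ (map (z ∷_) L₁′ ++ map (z ∷_) L₂′)
  ≡⟨ cong ((map (x ∷_) L₁ ++ map (y ∷_) L₂) ++_)
       (trans (sym (map-++ (z ∷_) L₁′ L₂′))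
              (cong (map (z ∷_)) (sym (concatMap-++ (_⧢ Z) (map (x ∷_) S₁) (map (y ∷_) S₂))))) ⟩
    (map (x ∷_) L₁ ++ map (y ∷_) L₂) ++ map (z ∷_) (concatMap (_⧢ Z) ((x ∷ X) ⧢ (y ∷ Y))) ∎
  where
  open PermutationReasoning
  S₁ = X ⧢ (y ∷ Y)
  S₂ = (x ∷ X) ⧢ Y
  L₁ = concatMap (_⧢ (z ∷ Z)) S₁
  L₂ = concatMap (_⧢ (z ∷ Z)) S₂
  L₁′ = concatMap (_⧢ Z) (map (x ∷_) S₁)
  L₂′ = concatMap (_⧢ Z) (map (y ∷_) S₂)

⧢-assoc-unfoldʳ : (x y z : A) (X Y Z : List A) →
                  concatMap ((x ∷ X) ⧢_) ((y ∷ Y) ⧢ (z ∷ Z))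
                    ↭ (map (x ∷_) (concatMap (X ⧢_) ((y ∷ Y) ⧢ (z ∷ Z)))
                         ++ map (y ∷_) (concatMap ((x ∷ X) ⧢_) (Y ⧢ (z ∷ Z))))
                      ++ map (z ∷_) (concatMap ((x ∷ X) ⧢_) ((y ∷ Y) ⧢ Z))
⧢-assoc-unfoldʳ x y z X Y Z = begin
    concatMap ((x ∷ X) ⧢_) (map (y ∷_) T₁ ++ map (z ∷_) T₂)
  ≡⟨ concatMap-++ ((x ∷ X) ⧢_) (map (y ∷_) T₁) (map (z ∷_) T₂) ⟩
    concatMap ((x ∷ X) ⧢_) (map (y ∷_) T₁) ++ concatMap ((x ∷ X) ⧢_) (map (z ∷_) T₂)
  ↭⟨ ++⁺ (concatMap-⧢-prefixʳ x y X T₁) (concatMap-⧢-prefixʳ x z X T₂) ⟩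
    (map (x ∷_) R₁′ ++ map (y ∷_) R₁) ++ (map (x ∷_) R₂′ ++ map (z ∷_) R₂)
  ↭⟨ ↭-interchange (map (x ∷_) R₁′) (map (y ∷_) R₁) (map (x ∷_) R₂′) (map (z ∷_) R₂) ⟩
    (map (x ∷_) R₁′ ++ map (x ∷_) R₂′) ++ (map (y ∷_) R₁ ++ map (z ∷_) R₂)
  ≡⟨ cong (_++ (map (y ∷_) R₁ ++ map (z ∷_) R₂))
       (trans (sym (map-++ (x ∷_) R₁′ R₂′))
              (cong (map (x ∷_)) (sym (concatMap-++ (X ⧢_) (map (y ∷_) T₁) (map (z ∷_) T₂))))) ⟩
    map (x ∷_) R ++ (map (y ∷_) R₁ ++ map (z ∷_) R₂)
  ≡⟨ ++-assoc (map (x ∷_) R) (map (y ∷_) R₁) (map (z ∷_) R₂) ⟨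
    (map (x ∷_) R ++ map (y ∷_) R₁) ++ map (z ∷_) R₂ ∎
  where
  open PermutationReasoning
  T₁ = Y ⧢ (z ∷ Z)
  T₂ = (y ∷ Y) ⧢ Z
  R = concatMap (X ⧢_) ((y ∷ Y) ⧢ (z ∷ Z))
  R₁ = concatMap ((x ∷ X) ⧢_) T₁
  R₂ = concatMap ((x ∷ X) ⧢_) T₂
  R₁′ = concatMap (X ⧢_) (map (y ∷_) T₁)
  R₂′ = concatMap (X ⧢_) (map (z ∷_) T₂)

-- both sides split into their x-, y- and z-initial words, each an instance for shorter words
⧢-assoc : (X Y Z : List A) → concatMap (_⧢ Z) (X ⧢ Y) ↭ concatMap (X ⧢_) (Y ⧢ Z)
⧢-assoc []      Y       Z       = ↭-reflexive (trans (++-identityʳ (Y ⧢ Z)) (sym (concatMap-pure (Y ⧢ Z))))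
⧢-assoc (x ∷ X) []      Z       = ↭-refl
⧢-assoc (x ∷ X) (y ∷ Y) []      = ↭-reflexive (trans (concatMap-cong ⧢-identityʳ ((x ∷ X) ⧢ (y ∷ Y)))
  (trans (concatMap-pure _) (sym (++-identityʳ _))))
⧢-assoc (x ∷ X) (y ∷ Y) (z ∷ Z) = ↭-trans (⧢-assoc-unfoldˡ x y z X Y Z)
  (↭-trans (++⁺ (++⁺ (map⁺-↭ (x ∷_) (⧢-assoc X (y ∷ Y) (z ∷ Z)))
                     (map⁺-↭ (y ∷_) (⧢-assoc (x ∷ X) Y (z ∷ Z))))
                (map⁺-↭ (z ∷_) (⧢-assoc (x ∷ X) (y ∷ Y) Z)))
           (↭-sym (⧢-assoc-unfoldʳ x y z X Y Z)))

-- Shuffles as interleavings along subsets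

hasSize : ∀ {k} (j : ℕ) (I : Vec Bool k) → Dec (card I ≡ j)
hasSize j I = card I ≟ j

subsetsOfSize : (k j : ℕ) → List (Vec Bool k)
subsetsOfSize k j = filter (hasSize j) (allSubsets k)

-- card (true ∷ I) ≟ suc j computes to the same decision as card I ≟ j
filter-hasSize-true∷ : ∀ {k} j (S : List (Vec Bool k)) →
                       filter (hasSize (suc j)) (map (true ∷ᵛ_) S) ≡ map (true ∷ᵛ_) (filter (hasSize j) S)
filter-hasSize-true∷ j []      = refl
filter-hasSize-true∷ j (I ∷ S) with does (hasSize j I)
... | true  = cong ((true ∷ᵛ I) ∷_) (filter-hasSize-true∷ j S)
... | false = filter-hasSize-true∷ j S

filter-hasSize-false∷ : ∀ {k} j (S : List (Vec Bool k)) →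
                        filter (hasSize j) (map (false ∷ᵛ_) S) ≡ map (false ∷ᵛ_) (filter (hasSize j) S)
filter-hasSize-false∷ j []      = refl
filter-hasSize-false∷ j (I ∷ S) with does (hasSize j I)
... | true  = cong ((false ∷ᵛ I) ∷_) (filter-hasSize-false∷ j S)
... | false = filter-hasSize-false∷ j S

filter-hasSize-zero-true∷ : ∀ {k} (S : List (Vec Bool k)) → filter (hasSize 0) (map (true ∷ᵛ_) S) ≡ []
filter-hasSize-zero-true∷ []      = refl
filter-hasSize-zero-true∷ (I ∷ S) = filter-hasSize-zero-true∷ S

subsetsOfSize-suc : ∀ k j → subsetsOfSize (suc k) (suc j)
                            ≡ map (true ∷ᵛ_) (subsetsOfSize k j) ++ map (false ∷ᵛ_) (subsetsOfSize k (suc j))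
subsetsOfSize-suc k j = trans (filter-++ (hasSize (suc j)) (map (true ∷ᵛ_) (allSubsets k)) _)
  (cong₂ _++_ (filter-hasSize-true∷ j (allSubsets k)) (filter-hasSize-false∷ (suc j) (allSubsets k)))

subsetsOfSize-zero : ∀ k → subsetsOfSize (suc k) 0 ≡ map (false ∷ᵛ_) (subsetsOfSize k 0)
subsetsOfSize-zero k = trans (filter-++ (hasSize 0) (map (true ∷ᵛ_) (allSubsets k)) _)
  (cong₂ _++_ (filter-hasSize-zero-true∷ (allSubsets k)) (filter-hasSize-false∷ 0 (allSubsets k)))

subsetsOfSize-> : ∀ k j → subsetsOfSize k (suc (k ℕ.+ j)) ≡ []
subsetsOfSize-> zero    j = refl
subsetsOfSize-> (suc k) j = trans (subsetsOfSize-suc k (suc (k ℕ.+ j))) (cong₂ _++_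
  (cong (map (true ∷ᵛ_)) (subsetsOfSize-> k j))
  (cong (map (false ∷ᵛ_)) (trans (cong (subsetsOfSize k ∘ suc) (sym (ℕ.+-suc k j))) (subsetsOfSize-> k (suc j)))))

subsetsOfSize-suc-self : ∀ k → subsetsOfSize (suc k) (suc k) ≡ map (true ∷ᵛ_) (subsetsOfSize k k)
subsetsOfSize-suc-self k = begin
    subsetsOfSize (suc k) (suc k)
  ≡⟨ subsetsOfSize-suc k k ⟩
    map (true ∷ᵛ_) (subsetsOfSize k k) ++ map (false ∷ᵛ_) (subsetsOfSize k (suc k))
  ≡⟨ cong (λ j → map (true ∷ᵛ_) (subsetsOfSize k k) ++ map (false ∷ᵛ_) (subsetsOfSize k (suc j)))
          (sym (ℕ.+-identityʳ k)) ⟩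
    map (true ∷ᵛ_) (subsetsOfSize k k) ++ map (false ∷ᵛ_) (subsetsOfSize k (suc (k ℕ.+ 0)))
  ≡⟨ cong (λ S → map (true ∷ᵛ_) (subsetsOfSize k k) ++ map (false ∷ᵛ_) S) (subsetsOfSize-> k 0) ⟩
    map (true ∷ᵛ_) (subsetsOfSize k k) ++ []
  ≡⟨ ++-identityʳ _ ⟩
    map (true ∷ᵛ_) (subsetsOfSize k k) ∎
  where open ≡-Reasoning

interleavings : (k : ℕ) → List A → List A → List (List A)
interleavings k u v = map (λ I → interleave I u v) (subsetsOfSize k (length u))

interleavings-true∷ : ∀ {k} (x : A) (u v : List A) (S : List (Vec Bool k)) →
                      map (λ I → interleave I (x ∷ u) v) (map (true ∷ᵛ_) S)
                        ≡ map (x ∷_) (map (λ I → interleave I u v) S)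
interleavings-true∷ x u v S = map∘map-cong (λ _ → refl) S

interleavings-false∷ : ∀ {k} (y : A) (u v : List A) (S : List (Vec Bool k)) →
                       map (λ I → interleave I u (y ∷ v)) (map (false ∷ᵛ_) S)
                         ≡ map (y ∷_) (map (λ I → interleave I u v) S)
interleavings-false∷ y u v S = map∘map-cong (λ _ → refl) S

interleavings-⧢ : ∀ k (u v : List A) → k ≡ length u ℕ.+ length v → interleavings k u v ≡ u ⧢ v
interleavings-⧢ zero    []      []      _  = refl
interleavings-⧢ (suc k) []      (y ∷ v) eq = begin
    map (λ I → interleave I [] (y ∷ v)) (subsetsOfSize (suc k) 0)
  ≡⟨ cong (map _) (subsetsOfSize-zero k) ⟩
    map (λ I → interleave I [] (y ∷ v)) (map (false ∷ᵛ_) (subsetsOfSize k 0))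
  ≡⟨ interleavings-false∷ y [] v (subsetsOfSize k 0) ⟩
    map (y ∷_) (interleavings k [] v)
  ≡⟨ cong (map (y ∷_)) (interleavings-⧢ k [] v (ℕ.suc-injective eq)) ⟩
    [ y ∷ v ] ∎
  where open ≡-Reasoning
interleavings-⧢ (suc k) (x ∷ u) []      eq with trans (ℕ.suc-injective eq) (ℕ.+-identityʳ (length u))
... | refl = begin
    map (λ I → interleave I (x ∷ u) []) (subsetsOfSize (suc k) (suc k))
  ≡⟨ cong (map _) (subsetsOfSize-suc-self k) ⟩
    map (λ I → interleave I (x ∷ u) []) (map (true ∷ᵛ_) (subsetsOfSize k k))
  ≡⟨ interleavings-true∷ x u [] (subsetsOfSize k k) ⟩
    map (x ∷_) (interleavings k u [])
  ≡⟨ cong (map (x ∷_)) (trans (interleavings-⧢ k u [] (sym (ℕ.+-identityʳ k))) (⧢-identityʳ u)) ⟩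
    [ x ∷ u ] ∎
  where open ≡-Reasoning
interleavings-⧢ (suc k) (x ∷ u) (y ∷ v) eq = begin
    map (λ I → interleave I (x ∷ u) (y ∷ v)) (subsetsOfSize (suc k) (suc (length u)))
  ≡⟨ cong (map _) (subsetsOfSize-suc k (length u)) ⟩
    map (λ I → interleave I (x ∷ u) (y ∷ v))
        (map (true ∷ᵛ_) (subsetsOfSize k (length u)) ++ map (false ∷ᵛ_) (subsetsOfSize k (suc (length u))))
  ≡⟨ map-++ _ (map (true ∷ᵛ_) (subsetsOfSize k (length u))) _ ⟩
    map (λ I → interleave I (x ∷ u) (y ∷ v)) (map (true ∷ᵛ_) (subsetsOfSize k (length u)))
      ++ map (λ I → interleave I (x ∷ u) (y ∷ v)) (map (false ∷ᵛ_) (subsetsOfSize k (suc (length u))))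
  ≡⟨ cong₂ _++_ (interleavings-true∷ x u (y ∷ v) (subsetsOfSize k (length u)))
                (interleavings-false∷ y (x ∷ u) v (subsetsOfSize k (suc (length u)))) ⟩
    map (x ∷_) (interleavings k u (y ∷ v)) ++ map (y ∷_) (interleavings k (x ∷ u) v)
  ≡⟨ cong₂ (λ s t → map (x ∷_) s ++ map (y ∷_) t)
       (interleavings-⧢ k u (y ∷ v) (ℕ.suc-injective eq))
       (interleavings-⧢ k (x ∷ u) v (trans (ℕ.suc-injective eq) (ℕ.+-suc (length u) (length v)))) ⟩
    (x ∷ u) ⧢ (y ∷ v) ∎
  where open ≡-Reasoning

sh≡⧢ : (u v : List A) → sh u v ≡ u ⧢ v
sh≡⧢ u v = interleavings-⧢ (length u ℕ.+ length v) u v refl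

-- Deconcatenations

deconcatenations : List A → List (List A × List A)
deconcatenations []      = [ ([] , []) ]
deconcatenations (x ∷ w) = ([] , x ∷ w) ∷ map (map₁ (x ∷_)) (deconcatenations w)

applyUpTo-take-drop : (w : List A) →
                      applyUpTo (λ i → (take i w , drop i w)) (suc (length w)) ≡ deconcatenations w
applyUpTo-take-drop []      = refl
applyUpTo-take-drop (x ∷ w) = cong (([] , x ∷ w) ∷_)
  (trans (sym (map-applyUpTo (λ i → (take i w , drop i w)) (map₁ (x ∷_)) (suc (length w))))
         (cong (map (map₁ (x ∷_))) (applyUpTo-take-drop w)))

map-take-drop-upTo : (w : List A) →
                     map (λ i → (take i w , drop i w)) (upTo (suc (length w))) ≡ deconcatenations w
map-take-drop-upTo w = trans (map-applyUpTo id _ (suc (length w))) (applyUpTo-take-drop w)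

deconcatenations-map : (f : A → B) (w : List A) →
                       deconcatenations (map f w) ≡ map (Product.map (map f) (map f)) (deconcatenations w)
deconcatenations-map f []      = refl
deconcatenations-map f (x ∷ w) = cong (([] , f x ∷ map f w) ∷_)
  (trans (cong (map (map₁ (f x ∷_))) (deconcatenations-map f w))
         (map∘map-cong (λ _ → refl) (deconcatenations w)))

deconcatenations-length : (w : List A) →
                          All (λ p → length (proj₁ p) ℕ.+ length (proj₂ p) ≡ length w) (deconcatenations w)
deconcatenations-length []      = refl ∷ []
deconcatenations-length (x ∷ w) = refl ∷ All-map⁺ (All.map (cong suc) (deconcatenations-length w))

deconcatenations-first : (w : List A) →
                         ∃[ L ] deconcatenations w ≡ ([] , w) ∷ L × All (λ p → proj₁ p ≢ []) L
deconcatenations-first []      = [] , refl , []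
deconcatenations-first (x ∷ w) = _ , refl , All-map⁺ (All.universal (λ _ ()) (deconcatenations w))

deconcatenations-last : (w : List A) →
                        ∃[ L ] deconcatenations w ≡ L ++ [ (w , []) ] × All (λ p → proj₂ p ≢ []) L
deconcatenations-last []      = [] , refl , []
deconcatenations-last (x ∷ w) with deconcatenations-last w
... | L , eq , nonempty =
  ([] , x ∷ w) ∷ map (map₁ (x ∷_)) L ,
  cong (([] , x ∷ w) ∷_) (trans (cong (map (map₁ (x ∷_))) eq) (map-++ (map₁ (x ∷_)) L _)) ,
  (λ ()) ∷ All-map⁺ nonempty

-- the terms of (Δ ⊗ id) Δ w and of (id ⊗ Δ) Δ w
deconcatenationsˡ : List A → List (List A × (List A × List A))
deconcatenationsˡ w = concatMap (λ p → map (map₂ (_, proj₂ p)) (deconcatenations (proj₁ p))) (deconcatenations w)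

deconcatenationsʳ : List A → List (List A × (List A × List A))
deconcatenationsʳ w = concatMap (λ p → map (proj₁ p ,_) (deconcatenations (proj₂ p))) (deconcatenations w)

deconcatenationsˡ-∷ : (x : A) (w : List A) →
                      deconcatenationsˡ (x ∷ w)
                        ↭ ([] , ([] , x ∷ w)) ∷ (map (λ p → ([] , map₁ (x ∷_) p)) (deconcatenations w)
                                                  ++ map (map₁ (x ∷_)) (deconcatenationsˡ w))
deconcatenationsˡ-∷ {A} x w = ↭-prep _ (begin
    concatMap split-left (map (map₁ (x ∷_)) Ds)
  ≡⟨ concatMap-map split-left (map₁ (x ∷_)) Ds ⟩
    concatMap (λ p → ([] , map₁ (x ∷_) p) ∷ map (map₂ (_, proj₂ p)) (map (map₁ (x ∷_)) (deconcatenations (proj₁ p))))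
              Ds
  ↭⟨ concatMap-∷-↭ (λ p → ([] , map₁ (x ∷_) p)) _ Ds ⟩
    map (λ p → ([] , map₁ (x ∷_) p)) Ds
      ++ concatMap (λ p → map (map₂ (_, proj₂ p)) (map (map₁ (x ∷_)) (deconcatenations (proj₁ p)))) Ds
  ≡⟨ cong (map (λ p → ([] , map₁ (x ∷_) p)) Ds ++_)
       (trans (concatMap-cong (λ p → map∘map-cong (λ _ → refl) (deconcatenations (proj₁ p))) Ds)
              (sym (map-concatMap (map₁ (x ∷_)) split-left Ds))) ⟩
    map (λ p → ([] , map₁ (x ∷_) p)) Ds ++ map (map₁ (x ∷_)) (concatMap split-left Ds) ∎)
  where
  open PermutationReasoning
  Ds = deconcatenations w
  split-left : List A × List A → List (List A × (List A × List A))
  split-left p = map (map₂ (_, proj₂ p)) (deconcatenations (proj₁ p))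

deconcatenationsʳ-∷ : (x : A) (w : List A) →
                      deconcatenationsʳ (x ∷ w)
                        ≡ ([] , ([] , x ∷ w)) ∷ (map (λ p → ([] , map₁ (x ∷_) p)) (deconcatenations w)
                                                  ++ map (map₁ (x ∷_)) (deconcatenationsʳ w))
deconcatenationsʳ-∷ x w = cong (([] , ([] , x ∷ w)) ∷_) (cong₂ _++_
  (sym (map-∘ (deconcatenations w)))
  (trans (concatMap-map _ (map₁ (x ∷_)) (deconcatenations w))
         (trans (concatMap-cong (λ p → map-∘ (deconcatenations (proj₂ p))) (deconcatenations w))
                (sym (map-concatMap (map₁ (x ∷_)) _ (deconcatenations w))))))

deconcatenations-coassoc : (w : List A) → deconcatenationsˡ w ↭ deconcatenationsʳ w
deconcatenations-coassoc []      = ↭-refl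
deconcatenations-coassoc (x ∷ w) = ↭-trans (deconcatenationsˡ-∷ x w)
  (↭-trans (↭-prep _ (++⁺ˡ _ (map⁺-↭ (map₁ (x ∷_)) (deconcatenations-coassoc w))))
           (↭-reflexive (sym (deconcatenationsʳ-∷ x w))))

-- Deconcatenation as a shuffle morphism

cartesianProduct-map : (f : A → C) (g : B → D) (as : List A) (bs : List B) →
                       cartesianProduct (map f as) (map g bs) ≡ map (Product.map f g) (cartesianProduct as bs)
cartesianProduct-map f g []       bs = refl
cartesianProduct-map f g (a ∷ as) bs =
  trans (cong₂ _++_ (map∘map-cong (λ _ → refl) bs) (cartesianProduct-map f g as bs))
        (sym (map-++ (Product.map f g) (map (a ,_) bs) _))

cartesianProduct-map₁ : (f : A → C) (as : List A) (bs : List B) →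
                        cartesianProduct (map f as) bs ≡ map (map₁ f) (cartesianProduct as bs)
cartesianProduct-map₁ f as bs = trans (cong (cartesianProduct (map f as)) (sym (map-id bs))) (cartesianProduct-map f id as bs)

cartesianProduct-singletonʳ : (as : List A) (b : B) → cartesianProduct as [ b ] ≡ map (_, b) as
cartesianProduct-singletonʳ []       b = refl
cartesianProduct-singletonʳ (a ∷ as) b = cong ((a , b) ∷_) (cartesianProduct-singletonʳ as b)

concatMap-cartesianProduct : (f : A × B → List C) (as : List A) (bs : List B) →
                             concatMap f (cartesianProduct as bs) ≡ concatMap (λ a → concatMap (λ b → f (a , b)) bs) as
concatMap-cartesianProduct f []       bs = refl
concatMap-cartesianProduct f (a ∷ as) bs = trans (concatMap-++ f (map (a ,_) bs) _)
  (cong₂ _++_ (concatMap-map f (a ,_) bs) (concatMap-cartesianProduct f as bs))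

infix 6 _⧢₂_

_⧢₂_ : List A × List A → List A × List A → List (List A × List A)
(u₁ , u₂) ⧢₂ (v₁ , v₂) = cartesianProduct (u₁ ⧢ v₁) (u₂ ⧢ v₂)

shuffleWithDeconcatenations : List A × List A → List A → List (List A × List A)
shuffleWithDeconcatenations p Y = concatMap (p ⧢₂_) (deconcatenations Y)

shuffleOfDeconcatenations : List A → List A → List (List A × List A)
shuffleOfDeconcatenations X Y = concatMap (λ p → shuffleWithDeconcatenations p Y) (deconcatenations X)

⧢₂-∷-∷ : (x y : A) (p q : List A × List A) →
         map₁ (x ∷_) p ⧢₂ map₁ (y ∷_) q
           ≡ map (map₁ (x ∷_)) (p ⧢₂ map₁ (y ∷_) q) ++ map (map₁ (y ∷_)) (map₁ (x ∷_) p ⧢₂ q)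
⧢₂-∷-∷ x y (p₁ , p₂) (q₁ , q₂) =
  trans (cartesianProductWith-distribʳ-++ _,_ (map (x ∷_) (p₁ ⧢ (y ∷ q₁))) (map (y ∷_) ((x ∷ p₁) ⧢ q₁))
                                             (p₂ ⧢ q₂))
        (cong₂ _++_ (cartesianProduct-map₁ (x ∷_) (p₁ ⧢ (y ∷ q₁)) (p₂ ⧢ q₂))
                    (cartesianProduct-map₁ (y ∷_) ((x ∷ p₁) ⧢ q₁) (p₂ ⧢ q₂)))

shuffleWithDeconcatenations-∷ : (x y : A) (Y : List A) (p : List A × List A) →
  shuffleWithDeconcatenations (map₁ (x ∷_) p) (y ∷ Y)
    ↭ map (map₁ (x ∷_)) (shuffleWithDeconcatenations p (y ∷ Y))
        ++ map (map₁ (y ∷_)) (shuffleWithDeconcatenations (map₁ (x ∷_) p) Y)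
shuffleWithDeconcatenations-∷ x y Y p@(p₁ , p₂) = begin
    (map₁ (x ∷_) p ⧢₂ ([] , y ∷ Y)) ++ concatMap (map₁ (x ∷_) p ⧢₂_) (map (map₁ (y ∷_)) Ds)
  ≡⟨ cong₂ _++_ first (concatMap-map (map₁ (x ∷_) p ⧢₂_) (map₁ (y ∷_)) Ds) ⟩
    map (map₁ (x ∷_)) P ++ concatMap (λ q → map₁ (x ∷_) p ⧢₂ map₁ (y ∷_) q) Ds
  ↭⟨ ++⁺ˡ _ (↭-trans (↭-reflexive (concatMap-cong (⧢₂-∷-∷ x y p) Ds))
                      (concatMap-map-++-↭ (map₁ (x ∷_)) (map₁ (y ∷_))
                                          (λ q → p ⧢₂ map₁ (y ∷_) q) (map₁ (x ∷_) p ⧢₂_) Ds)) ⟩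
    map (map₁ (x ∷_)) P ++ (map (map₁ (x ∷_)) Q ++ map (map₁ (y ∷_)) R)
  ≡⟨ ++-assoc (map (map₁ (x ∷_)) P) (map (map₁ (x ∷_)) Q) (map (map₁ (y ∷_)) R) ⟨
    (map (map₁ (x ∷_)) P ++ map (map₁ (x ∷_)) Q) ++ map (map₁ (y ∷_)) R
  ≡⟨ cong (_++ map (map₁ (y ∷_)) R)
       (trans (sym (map-++ (map₁ (x ∷_)) P Q))
              (cong (λ t → map (map₁ (x ∷_)) (P ++ t)) (sym (concatMap-map (p ⧢₂_) (map₁ (y ∷_)) Ds)))) ⟩
    map (map₁ (x ∷_)) (shuffleWithDeconcatenations p (y ∷ Y)) ++ map (map₁ (y ∷_)) R ∎
  where
  open PermutationReasoning
  Ds = deconcatenations Y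
  P = p ⧢₂ ([] , y ∷ Y)
  Q = concatMap (λ q → p ⧢₂ map₁ (y ∷_) q) Ds
  R = shuffleWithDeconcatenations (map₁ (x ∷_) p) Y
  first : map₁ (x ∷_) p ⧢₂ ([] , y ∷ Y) ≡ map (map₁ (x ∷_)) P
  first = trans (cartesianProduct-map₁ (x ∷_) [ p₁ ] (p₂ ⧢ (y ∷ Y)))
                (cong (λ s → map (map₁ (x ∷_)) (cartesianProduct s (p₂ ⧢ (y ∷ Y)))) (sym (⧢-identityʳ p₁)))

shuffleOfDeconcatenations-∷ : (x y : A) (X Y : List A) →
  shuffleOfDeconcatenations (x ∷ X) (y ∷ Y)
    ↭ (map ([] ,_) ((x ∷ X) ⧢ (y ∷ Y)) ++ map (map₁ (x ∷_)) (shuffleOfDeconcatenations X (y ∷ Y)))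
        ++ map (map₁ (y ∷_)) (shuffleOfDeconcatenations (x ∷ X) Y)
shuffleOfDeconcatenations-∷ x y X Y = begin
    Ψ (y ∷ Y) ([] , x ∷ X) ++ concatMap (Ψ (y ∷ Y)) (map (map₁ (x ∷_)) Ds)
  ≡⟨ cong₂ _++_ first (concatMap-map (Ψ (y ∷ Y)) (map₁ (x ∷_)) Ds) ⟩
    (S ++ map (map₁ (y ∷_)) (Ψ Y ([] , x ∷ X))) ++ concatMap (Ψ (y ∷ Y) ∘ map₁ (x ∷_)) Ds
  ↭⟨ ++⁺ˡ _ (↭-trans (concatMap-↭ (shuffleWithDeconcatenations-∷ x y Y) Ds)
                      (concatMap-map-++-↭ (map₁ (x ∷_)) (map₁ (y ∷_)) (Ψ (y ∷ Y)) (Ψ Y ∘ map₁ (x ∷_)) Ds)) ⟩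
    (S ++ map (map₁ (y ∷_)) (Ψ Y ([] , x ∷ X))) ++ (map (map₁ (x ∷_)) Φ₁ ++ map (map₁ (y ∷_)) R)
  ↭⟨ ↭-interchange S (map (map₁ (y ∷_)) (Ψ Y ([] , x ∷ X))) (map (map₁ (x ∷_)) Φ₁) (map (map₁ (y ∷_)) R) ⟩
    (S ++ map (map₁ (x ∷_)) Φ₁) ++ (map (map₁ (y ∷_)) (Ψ Y ([] , x ∷ X)) ++ map (map₁ (y ∷_)) R)
  ≡⟨ cong ((S ++ map (map₁ (x ∷_)) Φ₁) ++_)
       (trans (sym (map-++ (map₁ (y ∷_)) (Ψ Y ([] , x ∷ X)) R))
              (cong (λ t → map (map₁ (y ∷_)) (Ψ Y ([] , x ∷ X) ++ t)) (sym (concatMap-map (Ψ Y) (map₁ (x ∷_)) Ds)))) ⟩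
    (S ++ map (map₁ (x ∷_)) Φ₁) ++ map (map₁ (y ∷_)) (shuffleOfDeconcatenations (x ∷ X) Y) ∎
  where
  open PermutationReasoning
  Ψ : List A → List A × List A → List (List A × List A)
  Ψ Y p = shuffleWithDeconcatenations p Y
  Ds = deconcatenations X
  S = map ([] ,_) ((x ∷ X) ⧢ (y ∷ Y))
  Φ₁ = shuffleOfDeconcatenations X (y ∷ Y)
  R = concatMap (Ψ Y ∘ map₁ (x ∷_)) Ds
  first : Ψ (y ∷ Y) ([] , x ∷ X) ≡ S ++ map (map₁ (y ∷_)) (Ψ Y ([] , x ∷ X))
  first = cong₂ _++_ (++-identityʳ _)
    (trans (concatMap-map (([] , x ∷ X) ⧢₂_) (map₁ (y ∷_)) (deconcatenations Y))
    (trans (concatMap-cong (λ q → cartesianProduct-map₁ (y ∷_) [ proj₁ q ] ((x ∷ X) ⧢ proj₂ q)) (deconcatenations Y))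
           (sym (map-concatMap (map₁ (y ∷_)) (([] , x ∷ X) ⧢₂_) (deconcatenations Y)))))

concatMap-deconcatenations-∷ : (x : A) (S : List (List A)) →
  concatMap deconcatenations (map (x ∷_) S)
    ↭ map (λ u → ([] , x ∷ u)) S ++ map (map₁ (x ∷_)) (concatMap deconcatenations S)
concatMap-deconcatenations-∷ x S = ↭-trans (↭-reflexive (concatMap-map deconcatenations (x ∷_) S))
  (↭-trans (concatMap-∷-↭ (λ u → ([] , x ∷ u)) (map (map₁ (x ∷_)) ∘ deconcatenations) S)
           (↭-reflexive (cong (map (λ u → ([] , x ∷ u)) S ++_) (sym (map-concatMap (map₁ (x ∷_)) deconcatenations S)))))

concatMap-deconcatenations-⧢-∷ : (x y : A) (X Y : List A) →
  concatMap deconcatenations ((x ∷ X) ⧢ (y ∷ Y))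
    ↭ (map ([] ,_) ((x ∷ X) ⧢ (y ∷ Y)) ++ map (map₁ (x ∷_)) (concatMap deconcatenations (X ⧢ (y ∷ Y))))
        ++ map (map₁ (y ∷_)) (concatMap deconcatenations ((x ∷ X) ⧢ Y))
concatMap-deconcatenations-⧢-∷ x y X Y = begin
    concatMap deconcatenations (map (x ∷_) S₁ ++ map (y ∷_) S₂)
  ≡⟨ concatMap-++ deconcatenations (map (x ∷_) S₁) (map (y ∷_) S₂) ⟩
    concatMap deconcatenations (map (x ∷_) S₁) ++ concatMap deconcatenations (map (y ∷_) S₂)
  ↭⟨ ++⁺ (concatMap-deconcatenations-∷ x S₁) (concatMap-deconcatenations-∷ y S₂) ⟩
    (map (λ u → ([] , x ∷ u)) S₁ ++ map (map₁ (x ∷_)) D₁)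
      ++ (map (λ u → ([] , y ∷ u)) S₂ ++ map (map₁ (y ∷_)) D₂)
  ↭⟨ ↭-interchange (map (λ u → ([] , x ∷ u)) S₁) _ _ _ ⟩
    (map (λ u → ([] , x ∷ u)) S₁ ++ map (λ u → ([] , y ∷ u)) S₂)
      ++ (map (map₁ (x ∷_)) D₁ ++ map (map₁ (y ∷_)) D₂)
  ≡⟨ cong (_++ (map (map₁ (x ∷_)) D₁ ++ map (map₁ (y ∷_)) D₂))
       (trans (cong₂ _++_ (map-∘ S₁) (map-∘ S₂)) (sym (map-++ ([] ,_) (map (x ∷_) S₁) (map (y ∷_) S₂)))) ⟩
    map ([] ,_) ((x ∷ X) ⧢ (y ∷ Y)) ++ (map (map₁ (x ∷_)) D₁ ++ map (map₁ (y ∷_)) D₂)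
  ≡⟨ ++-assoc (map ([] ,_) ((x ∷ X) ⧢ (y ∷ Y))) _ _ ⟨
    (map ([] ,_) ((x ∷ X) ⧢ (y ∷ Y)) ++ map (map₁ (x ∷_)) D₁) ++ map (map₁ (y ∷_)) D₂ ∎
  where
  open PermutationReasoning
  S₁ = X ⧢ (y ∷ Y)
  S₂ = (x ∷ X) ⧢ Y
  D₁ = concatMap deconcatenations S₁
  D₂ = concatMap deconcatenations S₂

deconcatenations-⧢ : (X Y : List A) → concatMap deconcatenations (X ⧢ Y) ↭ shuffleOfDeconcatenations X Y
deconcatenations-⧢ []      Y       = ↭-reflexive (cong (_++ []) (sym (concatMap-pure (deconcatenations Y))))
deconcatenations-⧢ (x ∷ X) []      = ↭-reflexive (sym (trans
  (concatMap-cong (λ p → cong₂ (λ s t → cartesianProduct s t ++ []) (⧢-identityʳ (proj₁ p)) (⧢-identityʳ (proj₂ p)))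
                  (deconcatenations (x ∷ X)))
  (trans (concatMap-pure _) (sym (++-identityʳ _)))))
deconcatenations-⧢ (x ∷ X) (y ∷ Y) = ↭-trans (concatMap-deconcatenations-⧢-∷ x y X Y)
  (↭-trans (++⁺ (++⁺ˡ _ (map⁺-↭ (map₁ (x ∷_)) (deconcatenations-⧢ X (y ∷ Y))))
                (map⁺-↭ (map₁ (y ∷_)) (deconcatenations-⧢ (x ∷ X) Y)))
           (↭-sym (shuffleOfDeconcatenations-∷ x y X Y)))

-- Formal sums

module FormalSums {c ℓ} (F : Field c ℓ) where
  open Field F renaming (refl to ≈-refl; sym to ≈-sym; trans to ≈-trans)
  open Linear F renaming (_≈⟨_⟩_ to _≈[_]_)
  open CommutativeSemigroupProperties +-commutativeSemigroup using (x∙yz≈y∙xz)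
  import Relation.Binary.Reasoning.Setoid setoid as ≈-Reasoning

  private variable
    X Y : Set

  terms : FS X → List X
  terms = map proj₂

  UnitCoeffs : FS X → Set (c ⊔ ℓ)
  UnitCoeffs = All (λ p → proj₁ p ≈ 1#)

  fromList : List X → FS X
  fromList = map (1# ,_)

  coeff-↭ : (d : DecidableEquality X) {xs ys : FS X} → xs ↭ ys → ∀ x → coeff d xs x ≈ coeff d ys x
  coeff-↭ d (↭.refl)                       x = ≈-refl
  coeff-↭ d (↭.prep (a , y) p)             x with does (d y x)
  ... | true  = +-cong ≈-refl (coeff-↭ d p x)
  ... | false = coeff-↭ d p x
  coeff-↭ d (↭.swap (a , y) (b , z) p)     x with does (d y x) | does (d z x)
  ... | true  | true  = ≈-trans (+-cong ≈-refl (+-cong ≈-refl (coeff-↭ d p x))) (x∙yz≈y∙xz a b _)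
  ... | true  | false = +-cong ≈-refl (coeff-↭ d p x)
  ... | false | true  = +-cong ≈-refl (coeff-↭ d p x)
  ... | false | false = coeff-↭ d p x
  coeff-↭ d (↭.trans p q)                  x = ≈-trans (coeff-↭ d p x) (coeff-↭ d q x)

  coeff-unitCoeffs : (d : DecidableEquality X) {xs : FS X} → UnitCoeffs xs →
                     ∀ x → coeff d xs x ≈ coeff d (fromList (terms xs)) x
  coeff-unitCoeffs d {[]}           []          x = ≈-refl
  coeff-unitCoeffs d {(a , y) ∷ xs} (a≈1 ∷ one) x with does (d y x)
  ... | true  = +-cong a≈1 (coeff-unitCoeffs d one x)
  ... | false = coeff-unitCoeffs d one x

  coeff-fromList-map-injective : (dX : DecidableEquality X) (dY : DecidableEquality Y) {enc : X → Y} →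
                                 Injective _≡_ _≡_ enc → (L : List X) → ∀ x →
                                 coeff dY (fromList (map enc L)) (enc x) ≈ coeff dX (fromList L) x
  coeff-fromList-map-injective dX dY enc-inj []      x = ≈-refl
  coeff-fromList-map-injective dX dY {enc} enc-inj (y ∷ L) x with dX y x | dY (enc y) (enc x)
  ... | yes _    | yes _     = +-cong ≈-refl (coeff-fromList-map-injective dX dY enc-inj L x)
  ... | yes y≡x  | no  y′≢x′ = ⊥-elim (y′≢x′ (cong enc y≡x))
  ... | no  y≢x  | yes y′≡x′ = ⊥-elim (y≢x (enc-inj y′≡x′))
  ... | no  _    | no  _     = coeff-fromList-map-injective dX dY enc-inj L x

  terms-↭⇒≈ : (d : DecidableEquality X) {xs ys : FS X} → UnitCoeffs xs → UnitCoeffs ys →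
              terms xs ↭ terms ys → xs ≈[ d ] ys
  terms-↭⇒≈ d one₁ one₂ p x =
    ≈-trans (coeff-unitCoeffs d one₁ x) (≈-trans (coeff-↭ d (map⁺-↭ (1# ,_) p) x) (≈-sym (coeff-unitCoeffs d one₂ x)))

  encoded-terms-↭⇒≈ : (dX : DecidableEquality X) (dY : DecidableEquality Y) {enc : X → Y} →
                      Injective _≡_ _≡_ enc → {xs ys : FS X} → UnitCoeffs xs → UnitCoeffs ys →
                      map enc (terms xs) ↭ map enc (terms ys) → xs ≈[ dX ] ys
  encoded-terms-↭⇒≈ dX dY {enc} enc-inj {xs} {ys} one₁ one₂ p x = begin
      coeff dX xs x                                     ≈⟨ coeff-unitCoeffs dX one₁ x ⟩
      coeff dX (fromList (terms xs)) x                  ≈⟨ coeff-fromList-map-injective dX dY enc-inj (terms xs) x ⟨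
      coeff dY (fromList (map enc (terms xs))) (enc x)  ≈⟨ coeff-↭ dY (map⁺-↭ (1# ,_) p) (enc x) ⟩
      coeff dY (fromList (map enc (terms ys))) (enc x)  ≈⟨ coeff-fromList-map-injective dX dY enc-inj (terms ys) x ⟩
      coeff dX (fromList (terms ys)) x                  ≈⟨ coeff-unitCoeffs dX one₂ x ⟨
      coeff dX ys x                                     ∎
    where open ≈-Reasoning

  coeff-∉ : (d : DecidableEquality X) (xs : FS X) {x : X} → All (_≢ x) (terms xs) → coeff d xs x ≈ 0#
  coeff-∉ d []             []          = ≈-refl
  coeff-∉ d ((a , y) ∷ xs) {x} (y≢x ∷ ∉) with d y x
  ... | yes y≡x = ⊥-elim (y≢x y≡x)
  ... | no  _   = coeff-∉ d xs ∉

  coeff-++ : (d : DecidableEquality X) (xs ys : FS X) (x : X) → coeff d (xs ++ ys) x ≈ coeff d xs x + coeff d ys x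
  coeff-++ d []             ys x = ≈-sym (+-identityˡ _)
  coeff-++ d ((a , y) ∷ xs) ys x with does (d y x)
  ... | true  = ≈-trans (+-cong ≈-refl (coeff-++ d xs ys x)) (≈-sym (+-assoc a _ _))
  ... | false = coeff-++ d xs ys x

  coeff-scale : (d : DecidableEquality X) (a : Carrier) (xs : FS X) (x : X) → coeff d (scale a xs) x ≈ a * coeff d xs x
  coeff-scale d a []             x = ≈-sym (zeroʳ a)
  coeff-scale d a ((b , y) ∷ xs) x with does (d y x)
  ... | true  = ≈-trans (+-cong ≈-refl (coeff-scale d a xs x)) (≈-sym (distribˡ a b _))
  ... | false = coeff-scale d a xs x

  sum : List Carrier → Carrier
  sum = foldr _+_ 0#

  coeff-lin : (d : DecidableEquality Y) (h : X → FS Y) {xs : FS X} → UnitCoeffs xs → ∀ y →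
              coeff d (lin h xs) y ≈ sum (map (λ b → coeff d (h b) y) (terms xs))
  coeff-lin d h {[]}           []          y = ≈-refl
  coeff-lin d h {(a , b) ∷ xs} (a≈1 ∷ one) y = ≈-trans (coeff-++ d (scale a (h b)) (lin h xs) y)
    (+-cong (≈-trans (coeff-scale d a (h b) y) (≈-trans (*-cong a≈1 ≈-refl) (*-identityˡ _))) (coeff-lin d h one y))

  sum-map-≈0 : (f : A → Carrier) {L : List A} → All (λ a → f a ≈ 0#) L → sum (map f L) ≈ 0#
  sum-map-≈0 f []         = ≈-refl
  sum-map-≈0 f (fa≈0 ∷ z) = ≈-trans (+-cong fa≈0 (sum-map-≈0 f z)) (+-identityˡ 0#)

  sum-map-single : (f : A → Carrier) {L₁ L₂ : List A} (a : A) →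
                   All (λ b → f b ≈ 0#) L₁ → All (λ b → f b ≈ 0#) L₂ → sum (map f (L₁ ++ a ∷ L₂)) ≈ f a
  sum-map-single f a []          z₂ = ≈-trans (+-cong ≈-refl (sum-map-≈0 f z₂)) (+-identityʳ (f a))
  sum-map-single f a (fb≈0 ∷ z₁) z₂ = ≈-trans (+-cong fb≈0 (sum-map-single f a z₁ z₂)) (+-identityˡ (f a))

  terms-scale : (a : Carrier) (xs : FS X) → terms (scale a xs) ≡ terms xs
  terms-scale a xs = sym (map-∘ xs)

  terms-lin : (f : X → FS Y) (xs : FS X) → terms (lin f xs) ≡ concatMap (terms ∘ f) (terms xs)
  terms-lin f []             = refl
  terms-lin f ((a , x) ∷ xs) =
    trans (map-++ proj₂ (scale a (f x)) _) (cong₂ _++_ (terms-scale a (f x)) (terms-lin f xs))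

  terms-⊗ₑ : (xs : FS X) (ys : FS Y) → terms (xs ⊗ₑ ys) ≡ cartesianProduct (terms xs) (terms ys)
  terms-⊗ₑ []             ys = refl
  terms-⊗ₑ ((a , x) ∷ xs) ys = trans (map-++ proj₂ (map (λ q → (a * proj₁ q , (x , proj₂ q))) ys) _)
    (cong₂ _++_ (map∘map-cong (λ _ → refl) ys) (terms-⊗ₑ xs ys))

  terms-⊗ₘ : {X′ Y′ : Set} (f : FS X → FS X′) (g : FS Y → FS Y′) (zs : FS (X × Y)) →
             terms ((f ⊗ₘ g) zs)
               ≡ concatMap (λ p → cartesianProduct (terms (f (η (proj₁ p)))) (terms (g (η (proj₂ p))))) (terms zs)
  terms-⊗ₘ f g zs =
    trans (terms-lin _ zs) (concatMap-cong (λ p → terms-⊗ₑ (f (η (proj₁ p))) (g (η (proj₂ p)))) (terms zs))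

  terms-map-1# : (h : A → X) (L : List A) → terms (map (λ u → (1# , h u)) L) ≡ map h L
  terms-map-1# h L = sym (map-∘ L)

  unitCoeffs-η : (x : X) → UnitCoeffs (η x)
  unitCoeffs-η x = ≈-refl ∷ []

  unitCoeffs-map-1# : (h : A → X) (L : List A) → UnitCoeffs (map (λ u → (1# , h u)) L)
  unitCoeffs-map-1# h L = All-map⁺ (All.universal (λ _ → ≈-refl) L)

  unitCoeffs-lin : (f : X → FS Y) → (∀ x → UnitCoeffs (f x)) → {xs : FS X} → UnitCoeffs xs → UnitCoeffs (lin f xs)
  unitCoeffs-lin f one-f []          = []
  unitCoeffs-lin f one-f (a≈1 ∷ one) = All-++⁺
    (All-map⁺ (All.map (λ b≈1 → ≈-trans (*-cong a≈1 b≈1) (*-identityˡ 1#)) (one-f _))) (unitCoeffs-lin f one-f one)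

  unitCoeffs-⊗ₑ : {xs : FS X} {ys : FS Y} → UnitCoeffs xs → UnitCoeffs ys → UnitCoeffs (xs ⊗ₑ ys)
  unitCoeffs-⊗ₑ []          one′ = []
  unitCoeffs-⊗ₑ (a≈1 ∷ one) one′ = All-++⁺
    (All-map⁺ (All.map (λ b≈1 → ≈-trans (*-cong a≈1 b≈1) (*-identityˡ 1#)) one′)) (unitCoeffs-⊗ₑ one one′)

  unitCoeffs-⊗ₘ : {X′ Y′ : Set} (f : FS X → FS X′) (g : FS Y → FS Y′) →
                  (∀ x → UnitCoeffs (f (η x))) → (∀ y → UnitCoeffs (g (η y))) →
                  {zs : FS (X × Y)} → UnitCoeffs zs → UnitCoeffs ((f ⊗ₘ g) zs)
  unitCoeffs-⊗ₘ f g one-f one-g = unitCoeffs-lin _ (λ p → unitCoeffs-⊗ₑ (one-f (proj₁ p)) (one-g (proj₂ p)))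

  coeff-scale-≈0 : (d : DecidableEquality X) {a : Carrier} (xs : FS X) (x : X) → a ≈ 0# → coeff d (scale a xs) x ≈ 0#
  coeff-scale-≈0 d {a} xs x a≈0 = ≈-trans (coeff-scale d a xs x) (≈-trans (*-cong a≈0 ≈-refl) (zeroˡ _))

  coeff-scale-≈1 : (d : DecidableEquality X) {a : Carrier} (xs : FS X) (x : X) → a ≈ 1# →
                   coeff d (scale a xs) x ≈ coeff d xs x
  coeff-scale-≈1 d {a} xs x a≈1 = ≈-trans (coeff-scale d a xs x) (≈-trans (*-cong a≈1 ≈-refl) (*-identityˡ _))

-- Reading letters in ℕ removes the bound n from their type, so that terms indexed by
-- (m + n) + k and by m + (n + k) can be compared without transport.
Code : Set
Code = ℕ × List ℕ

encode : Basis → Code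
encode (n , w) = (n , map toℕ w)

encode-injective : Injective _≡_ _≡_ encode
encode-injective {n , w} {n′ , w′} eq with cong proj₁ eq
... | refl = cong (n ,_) (map-injective Fin.toℕ-injective (cong proj₂ eq))

_≟ᶜ_ : DecidableEquality Code
_≟ᶜ_ = ×-≡-dec ℕ._≟_ (≡-dec ℕ._≟_)

mulCode : Code → Code → List Code
mulCode (m , v) (n , w) = map (m ℕ.+ n ,_) (v ⧢ map (m ℕ.+_) w)

mulCode-assoc : (a b d : Code) → concatMap (λ e → mulCode e d) (mulCode a b) ↭ concatMap (mulCode a) (mulCode b d)
mulCode-assoc (m , u) (n , v) (k , w) = begin
    concatMap (λ e → mulCode e (k , w)) (map (m ℕ.+ n ,_) (u ⧢ map (m ℕ.+_) v))
  ≡⟨ trans (concatMap-map (λ e → mulCode e (k , w)) (m ℕ.+ n ,_) (u ⧢ map (m ℕ.+_) v))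
           (sym (map-concatMap (m ℕ.+ n ℕ.+ k ,_) (_⧢ map (m ℕ.+ n ℕ.+_) w) (u ⧢ map (m ℕ.+_) v))) ⟩
    map (m ℕ.+ n ℕ.+ k ,_) (concatMap (_⧢ map (m ℕ.+ n ℕ.+_) w) (u ⧢ map (m ℕ.+_) v))
  ↭⟨ map⁺-↭ (m ℕ.+ n ℕ.+ k ,_) (⧢-assoc u (map (m ℕ.+_) v) (map (m ℕ.+ n ℕ.+_) w)) ⟩
    map (m ℕ.+ n ℕ.+ k ,_) (concatMap (u ⧢_) (map (m ℕ.+_) v ⧢ map (m ℕ.+ n ℕ.+_) w))
  ≡⟨ cong₂ (λ N w′ → map (N ,_) (concatMap (u ⧢_) (map (m ℕ.+_) v ⧢ w′)))
           (ℕ.+-assoc m n k) (trans (map-cong (ℕ.+-assoc m n) w) (map-∘ w)) ⟩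
    map (m ℕ.+ (n ℕ.+ k) ,_) (concatMap (u ⧢_) (map (m ℕ.+_) v ⧢ map (m ℕ.+_) (map (n ℕ.+_) w)))
  ≡⟨ cong (map (m ℕ.+ (n ℕ.+ k) ,_) ∘ concatMap (u ⧢_)) (sym (map-⧢ (m ℕ.+_) v (map (n ℕ.+_) w))) ⟩
    map (m ℕ.+ (n ℕ.+ k) ,_) (concatMap (u ⧢_) (map (map (m ℕ.+_)) (v ⧢ map (n ℕ.+_) w)))
  ≡⟨ trans (cong (map (m ℕ.+ (n ℕ.+ k) ,_)) (concatMap-map (u ⧢_) (map (m ℕ.+_)) (v ⧢ map (n ℕ.+_) w)))
     (trans (map-concatMap (m ℕ.+ (n ℕ.+ k) ,_) (λ s → u ⧢ map (m ℕ.+_) s) (v ⧢ map (n ℕ.+_) w))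
            (sym (concatMap-map (mulCode (m , u)) (n ℕ.+ k ,_) (v ⧢ map (n ℕ.+_) w)))) ⟩
    concatMap (mulCode (m , u)) (map (n ℕ.+ k ,_) (v ⧢ map (n ℕ.+_) w)) ∎
  where open PermutationReasoning

-- The word bialgebra

module WordBialgebraLaws {c ℓ} (F : Field c ℓ) where
  open Field F renaming (refl to ≈-refl; sym to ≈-sym; trans to ≈-trans; reflexive to ≈-reflexive)
  open WordAlgebra F renaming (_≈⟨_⟩_ to _≈[_]_)
  open FormalSums F
  import Relation.Binary.Reasoning.Setoid setoid as ≈-Reasoning

  split : ∀ n → List (Fin n) × List (Fin n) → Basis × Basis
  split n = Product.map (n ,_) (n ,_)

  mulB′ : Basis × Basis → W
  mulB′ p = mulB (proj₁ p) (proj₂ p)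

  mulCode′ : Basis × Basis → List Code
  mulCode′ p = mulCode (encode (proj₁ p)) (encode (proj₂ p))

  terms-mulB : ∀ m (v : List (Fin m)) n (w : List (Fin n)) →
               terms (mulB (m , v) (n , w)) ≡ map (m ℕ.+ n ,_) (map (_↑ˡ n) v ⧢ map (m ↑ʳ_) w)
  terms-mulB m v n w = trans (terms-map-1# (m ℕ.+ n ,_) (sh (map (_↑ˡ n) v) (map (m ↑ʳ_) w)))
                             (cong (map (m ℕ.+ n ,_)) (sh≡⧢ (map (_↑ˡ n) v) (map (m ↑ʳ_) w)))

  terms-comulB : ∀ n (w : List (Fin n)) → terms (comulB (n , w)) ≡ map (split n) (deconcatenations w)
  terms-comulB n w = trans (terms-map-1# _ (upTo (suc (length w))))
    (trans (map-∘ (upTo (suc (length w)))) (cong (map (split n)) (map-take-drop-upTo w)))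

  terms-∇-η⊗η : (a b : Basis) → terms (∇sh (η a ⊗ₑ η b)) ≡ terms (mulB a b)
  terms-∇-η⊗η a b = trans (terms-lin mulB′ (η a ⊗ₑ η b)) (++-identityʳ (terms (mulB a b)))

  terms-∇-η : (p : Basis × Basis) → terms (∇sh (η p)) ≡ terms (mulB′ p)
  terms-∇-η p = trans (terms-lin mulB′ (η p)) (++-identityʳ (terms (mulB′ p)))

  terms-Δ-η : ∀ n (w : List (Fin n)) → terms (Δ⊙ (η (n , w))) ≡ map (split n) (deconcatenations w)
  terms-Δ-η n w = trans (terms-lin comulB (η (n , w))) (trans (++-identityʳ _) (terms-comulB n w))

  unitCoeffs-∇ : {zs : FS (Basis × Basis)} → UnitCoeffs zs → UnitCoeffs (∇sh zs)
  unitCoeffs-∇ = unitCoeffs-lin mulB′ λ { ((m , v) , (n , w)) →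
    unitCoeffs-map-1# (m ℕ.+ n ,_) (sh (map (_↑ˡ n) v) (map (m ↑ʳ_) w)) }

  unitCoeffs-Δ : {xs : W} → UnitCoeffs xs → UnitCoeffs (Δ⊙ xs)
  unitCoeffs-Δ = unitCoeffs-lin comulB λ { (n , w) →
    unitCoeffs-map-1# (λ i → ((n , take i w) , (n , drop i w))) (upTo (suc (length w))) }

  unitCoeffs-∇-η⊗η : (a b : Basis) → UnitCoeffs (∇sh (η a ⊗ₑ η b))
  unitCoeffs-∇-η⊗η a b = unitCoeffs-∇ (unitCoeffs-⊗ₑ (unitCoeffs-η a) (unitCoeffs-η b))

  unitCoeffs-Δ-η : (b : Basis) → UnitCoeffs (Δ⊙ (η b))
  unitCoeffs-Δ-η b = unitCoeffs-Δ (unitCoeffs-η b)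

  encode-mulB : (a b : Basis) → map encode (terms (mulB a b)) ≡ mulCode (encode a) (encode b)
  encode-mulB (m , v) (n , w) = begin
      map encode (terms (mulB (m , v) (n , w)))
    ≡⟨ cong (map encode) (terms-mulB m v n w) ⟩
      map encode (map (m ℕ.+ n ,_) (map (_↑ˡ n) v ⧢ map (m ↑ʳ_) w))
    ≡⟨ map∘map-cong (λ _ → refl) _ ⟩
      map (m ℕ.+ n ,_) (map (map toℕ) (map (_↑ˡ n) v ⧢ map (m ↑ʳ_) w))
    ≡⟨ cong (map (m ℕ.+ n ,_)) (map-⧢ toℕ (map (_↑ˡ n) v) (map (m ↑ʳ_) w)) ⟩
      map (m ℕ.+ n ,_) (map toℕ (map (_↑ˡ n) v) ⧢ map toℕ (map (m ↑ʳ_) w))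
    ≡⟨ cong₂ (λ s t → map (m ℕ.+ n ,_) (s ⧢ t))
         (trans (sym (map-∘ v)) (map-cong (λ i → Fin.toℕ-↑ˡ i n) v))
         (trans (sym (map-∘ w)) (trans (map-cong (Fin.toℕ-↑ʳ m) w) (map-∘ w))) ⟩
      mulCode (encode (m , v)) (encode (n , w)) ∎
    where open ≡-Reasoning

  encode-∇-⊗ₑ : (xs ys : W) →
                map encode (terms (∇sh (xs ⊗ₑ ys))) ≡ concatMap mulCode′ (cartesianProduct (terms xs) (terms ys))
  encode-∇-⊗ₑ xs ys = begin
      map encode (terms (∇sh (xs ⊗ₑ ys)))
    ≡⟨ cong (map encode) (trans (terms-lin mulB′ (xs ⊗ₑ ys)) (cong (concatMap (terms ∘ mulB′)) (terms-⊗ₑ xs ys))) ⟩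
      map encode (concatMap (terms ∘ mulB′) P)
    ≡⟨ trans (map-concatMap encode (terms ∘ mulB′) P) (concatMap-cong (λ p → encode-mulB (proj₁ p) (proj₂ p)) P) ⟩
      concatMap mulCode′ P ∎
    where
    open ≡-Reasoning
    P = cartesianProduct (terms xs) (terms ys)

  encode-∇-∇-η : (a b d : Basis) → map encode (terms (∇sh (∇sh (η a ⊗ₑ η b) ⊗ₑ η d)))
                 ≡ concatMap (λ e → mulCode e (encode d)) (mulCode (encode a) (encode b))
  encode-∇-∇-η a b d = begin
      map encode (terms (∇sh (∇sh (η a ⊗ₑ η b) ⊗ₑ η d)))
    ≡⟨ encode-∇-⊗ₑ (∇sh (η a ⊗ₑ η b)) (η d) ⟩
      concatMap mulCode′ (cartesianProduct L [ d ])
    ≡⟨ trans (cong (concatMap mulCode′) (cartesianProduct-singletonʳ L d)) (concatMap-map mulCode′ (_, d) L) ⟩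
      concatMap (λ e → mulCode (encode e) (encode d)) L
    ≡⟨ sym (concatMap-map (λ e → mulCode e (encode d)) encode L) ⟩
      concatMap (λ e → mulCode e (encode d)) (map encode L)
    ≡⟨ cong (concatMap (λ e → mulCode e (encode d))) (trans (cong (map encode) (terms-∇-η⊗η a b)) (encode-mulB a b)) ⟩
      concatMap (λ e → mulCode e (encode d)) (mulCode (encode a) (encode b)) ∎
    where
    open ≡-Reasoning
    L = terms (∇sh (η a ⊗ₑ η b))

  encode-η-∇-η : (a b d : Basis) → map encode (terms (∇sh (η a ⊗ₑ ∇sh (η b ⊗ₑ η d))))
                 ≡ concatMap (mulCode (encode a)) (mulCode (encode b) (encode d))
  encode-η-∇-η a b d = begin
      map encode (terms (∇sh (η a ⊗ₑ ∇sh (η b ⊗ₑ η d))))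
    ≡⟨ encode-∇-⊗ₑ (η a) (∇sh (η b ⊗ₑ η d)) ⟩
      concatMap mulCode′ (map (a ,_) L ++ [])
    ≡⟨ trans (cong (concatMap mulCode′) (++-identityʳ (map (a ,_) L))) (concatMap-map mulCode′ (a ,_) L) ⟩
      concatMap (λ e → mulCode (encode a) (encode e)) L
    ≡⟨ sym (concatMap-map (mulCode (encode a)) encode L) ⟩
      concatMap (mulCode (encode a)) (map encode L)
    ≡⟨ cong (concatMap (mulCode (encode a))) (trans (cong (map encode) (terms-∇-η⊗η b d)) (encode-mulB b d)) ⟩
      concatMap (mulCode (encode a)) (mulCode (encode b) (encode d)) ∎
    where
    open ≡-Reasoning
    L = terms (∇sh (η b ⊗ₑ η d))

  ∇-assoc : ∀ a b d → ∇sh (∇sh (η a ⊗ₑ η b) ⊗ₑ η d) ≈W ∇sh (η a ⊗ₑ ∇sh (η b ⊗ₑ η d))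
  ∇-assoc a b d = encoded-terms-↭⇒≈ _≟B_ _≟ᶜ_ encode-injective
    (unitCoeffs-∇ (unitCoeffs-⊗ₑ (unitCoeffs-∇-η⊗η a b) (unitCoeffs-η d)))
    (unitCoeffs-∇ (unitCoeffs-⊗ₑ (unitCoeffs-η a) (unitCoeffs-∇-η⊗η b d)))
    (↭-trans (↭-reflexive (encode-∇-∇-η a b d))
             (↭-trans (mulCode-assoc (encode a) (encode b) (encode d)) (↭-reflexive (sym (encode-η-∇-η a b d)))))

  ∇-unitˡ : ∀ b → ∇sh (ι 1# ⊗ₑ η b) ≈W η b
  ∇-unitˡ (n , w) = terms-↭⇒≈ _≟B_ (unitCoeffs-∇-η⊗η (0 , []) (n , w)) (unitCoeffs-η (n , w))
    (↭-reflexive (trans (terms-∇-η⊗η (0 , []) (n , w))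
                        (trans (terms-mulB 0 [] n w) (cong (λ u → [ (n , u) ]) (map-id w)))))

  ∇-unitʳ : ∀ b → ∇sh (η b ⊗ₑ ι 1#) ≈W η b
  ∇-unitʳ (n , w) = encoded-terms-↭⇒≈ _≟B_ _≟ᶜ_ encode-injective
    (unitCoeffs-∇-η⊗η (n , w) (0 , [])) (unitCoeffs-η (n , w))
    (↭-reflexive (trans (cong (map encode) (terms-∇-η⊗η (n , w) (0 , [])))
                 (trans (encode-mulB (n , w) (0 , []))
                 (cong₂ (λ k s → map (k ,_) s) (ℕ.+-identityʳ n) (⧢-identityʳ (map toℕ w))))))

  split₃ : ∀ n → List (Fin n) × (List (Fin n) × List (Fin n)) → Basis × (Basis × Basis)
  split₃ n = Product.map (n ,_) (split n)

  terms-Δ⊗id-Δ : ∀ n (w : List (Fin n)) →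
                 terms (assocₘ ((Δ⊙ ⊗ₘ idₘ) (Δ⊙ (η (n , w))))) ≡ map (split₃ n) (deconcatenationsˡ w)
  terms-Δ⊗id-Δ n w = begin
      terms (assocₘ Z)
    ≡⟨ map∘map-cong (λ _ → refl) Z ⟩
      map α (terms Z)
    ≡⟨ cong (map α) (trans (terms-⊗ₘ Δ⊙ idₘ (Δ⊙ (η (n , w)))) (cong (concatMap G) (terms-Δ-η n w))) ⟩
      map α (concatMap G (map (split n) (deconcatenations w)))
    ≡⟨ trans (cong (map α) (concatMap-map G (split n) (deconcatenations w)))
             (map-concatMap α (G ∘ split n) (deconcatenations w)) ⟩
      concatMap (map α ∘ G ∘ split n) (deconcatenations w)
    ≡⟨ concatMap-cong factor (deconcatenations w) ⟩
      concatMap (λ p → map (split₃ n) (map (map₂ (_, proj₂ p)) (deconcatenations (proj₁ p)))) (deconcatenations w)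
    ≡⟨ sym (map-concatMap (split₃ n) _ (deconcatenations w)) ⟩
      map (split₃ n) (deconcatenationsˡ w) ∎
    where
    open ≡-Reasoning
    Z = (Δ⊙ ⊗ₘ idₘ) (Δ⊙ (η (n , w)))
    α : (Basis × Basis) × Basis → Basis × (Basis × Basis)
    α t = (proj₁ (proj₁ t) , (proj₂ (proj₁ t) , proj₂ t))
    G : Basis × Basis → List ((Basis × Basis) × Basis)
    G p = cartesianProduct (terms (Δ⊙ (η (proj₁ p)))) [ proj₂ p ]
    factor : ∀ p → map α (G (split n p))
                   ≡ map (split₃ n) (map (map₂ (_, proj₂ p)) (deconcatenations (proj₁ p)))
    factor (p₁ , p₂) = begin
        map α (cartesianProduct (terms (Δ⊙ (η (n , p₁)))) [ (n , p₂) ])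
      ≡⟨ cong (map α) (trans (cong (λ L → cartesianProduct L [ (n , p₂) ]) (terms-Δ-η n p₁))
                             (cartesianProduct-singletonʳ _ (n , p₂))) ⟩
        map α (map (_, (n , p₂)) (map (split n) (deconcatenations p₁)))
      ≡⟨ trans (cong (map α) (sym (map-∘ (deconcatenations p₁)))) (map∘map-cong (λ _ → refl) (deconcatenations p₁)) ⟩
        map (split₃ n) (map (map₂ (_, p₂)) (deconcatenations p₁)) ∎

  terms-id⊗Δ-Δ : ∀ n (w : List (Fin n)) →
                 terms ((idₘ ⊗ₘ Δ⊙) (Δ⊙ (η (n , w)))) ≡ map (split₃ n) (deconcatenationsʳ w)
  terms-id⊗Δ-Δ n w = begin
      terms ((idₘ ⊗ₘ Δ⊙) (Δ⊙ (η (n , w))))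
    ≡⟨ trans (terms-⊗ₘ idₘ Δ⊙ (Δ⊙ (η (n , w)))) (cong (concatMap G) (terms-Δ-η n w)) ⟩
      concatMap G (map (split n) (deconcatenations w))
    ≡⟨ trans (concatMap-map G (split n) (deconcatenations w)) (concatMap-cong factor (deconcatenations w)) ⟩
      concatMap (λ p → map (split₃ n) (map (proj₁ p ,_) (deconcatenations (proj₂ p)))) (deconcatenations w)
    ≡⟨ sym (map-concatMap (split₃ n) _ (deconcatenations w)) ⟩
      map (split₃ n) (deconcatenationsʳ w) ∎
    where
    open ≡-Reasoning
    G : Basis × Basis → List (Basis × (Basis × Basis))
    G p = cartesianProduct [ proj₁ p ] (terms (Δ⊙ (η (proj₂ p))))
    factor : ∀ p → G (split n p) ≡ map (split₃ n) (map (proj₁ p ,_) (deconcatenations (proj₂ p)))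
    factor (p₁ , p₂) = begin
        map ((n , p₁) ,_) (terms (Δ⊙ (η (n , p₂)))) ++ []
      ≡⟨ trans (++-identityʳ _) (cong (map ((n , p₁) ,_)) (terms-Δ-η n p₂)) ⟩
        map ((n , p₁) ,_) (map (split n) (deconcatenations p₂))
      ≡⟨ map∘map-cong (λ _ → refl) (deconcatenations p₂) ⟩
        map (split₃ n) (map (p₁ ,_) (deconcatenations p₂)) ∎

  Δ-coassoc : ∀ b → assocₘ ((Δ⊙ ⊗ₘ idₘ) (Δ⊙ (η b))) ≈W³ (idₘ ⊗ₘ Δ⊙) (Δ⊙ (η b))
  Δ-coassoc (n , w) = terms-↭⇒≈ _≟B3_
    (All-map⁺ (unitCoeffs-⊗ₘ Δ⊙ idₘ unitCoeffs-Δ-η unitCoeffs-η (unitCoeffs-Δ-η (n , w))))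
    (unitCoeffs-⊗ₘ idₘ Δ⊙ unitCoeffs-η unitCoeffs-Δ-η (unitCoeffs-Δ-η (n , w)))
    (↭-trans (↭-reflexive (terms-Δ⊗id-Δ n w))
             (↭-trans (map⁺-↭ (split₃ n) (deconcatenations-coassoc w)) (↭-reflexive (sym (terms-id⊗Δ-Δ n w)))))

  ε⊙-η-[] : ∀ n → ε⊙ (η (n , [])) ≈ 1#
  ε⊙-η-[] n = ≈-trans (+-identityʳ _) (*-identityˡ 1#)

  ε⊙-η-nonempty : ∀ n {u : List (Fin n)} → u ≢ [] → ε⊙ (η (n , u)) ≈ 0#
  ε⊙-η-nonempty n {[]}    u≢[] = ⊥-elim (u≢[] refl)
  ε⊙-η-nonempty n {x ∷ u} _    = ≈-trans (+-identityʳ _) (zeroʳ 1#)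

  coeff-lin-Δ-η : (h : Basis × Basis → W) (n : ℕ) (w : List (Fin n)) (x : Basis) →
                  coeff _≟B_ (lin h (Δ⊙ (η (n , w)))) x
                    ≈ sum (map (λ p → coeff _≟B_ (h (split n p)) x) (deconcatenations w))
  coeff-lin-Δ-η h n w x = ≈-trans (coeff-lin _≟B_ h (unitCoeffs-Δ-η (n , w)) x)
    (≈-reflexive (cong sum (trans (cong (map (λ b → coeff _≟B_ (h b) x)) (terms-Δ-η n w))
                                  (sym (map-∘ (deconcatenations w))))))

  ε-counitˡ : ∀ b → lin (λ p → scale (ε⊙ (η (proj₁ p))) (η (proj₂ p))) (Δ⊙ (η b)) ≈W η b
  ε-counitˡ (n , w) x with deconcatenations-first w
  ... | L , eq , nonempty = begin
      coeff _≟B_ (lin h (Δ⊙ (η (n , w)))) x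
    ≈⟨ coeff-lin-Δ-η h n w x ⟩
      sum (map f (deconcatenations w))
    ≡⟨ cong (sum ∘ map f) eq ⟩
      sum (map f ([] ++ ([] , w) ∷ L))
    ≈⟨ sum-map-single f ([] , w) [] (All.map vanish nonempty) ⟩
      coeff _≟B_ (scale (ε⊙ (η (n , []))) (η (n , w))) x
    ≈⟨ coeff-scale-≈1 _≟B_ (η (n , w)) x (ε⊙-η-[] n) ⟩
      coeff _≟B_ (η (n , w)) x ∎
    where
    open ≈-Reasoning
    h : Basis × Basis → W
    h p = scale (ε⊙ (η (proj₁ p))) (η (proj₂ p))
    f : List (Fin n) × List (Fin n) → Carrier
    f p = coeff _≟B_ (h (split n p)) x
    vanish : ∀ {p} → proj₁ p ≢ [] → f p ≈ 0#
    vanish {p} ne = coeff-scale-≈0 _≟B_ (η (n , proj₂ p)) x (ε⊙-η-nonempty n ne)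

  ε-counitʳ : ∀ b → lin (λ p → scale (ε⊙ (η (proj₂ p))) (η (proj₁ p))) (Δ⊙ (η b)) ≈W η b
  ε-counitʳ (n , w) x with deconcatenations-last w
  ... | L , eq , nonempty = begin
      coeff _≟B_ (lin h (Δ⊙ (η (n , w)))) x
    ≈⟨ coeff-lin-Δ-η h n w x ⟩
      sum (map f (deconcatenations w))
    ≡⟨ cong (sum ∘ map f) eq ⟩
      sum (map f (L ++ (w , []) ∷ []))
    ≈⟨ sum-map-single f (w , []) (All.map vanish nonempty) [] ⟩
      coeff _≟B_ (scale (ε⊙ (η (n , []))) (η (n , w))) x
    ≈⟨ coeff-scale-≈1 _≟B_ (η (n , w)) x (ε⊙-η-[] n) ⟩
      coeff _≟B_ (η (n , w)) x ∎
    where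
    open ≈-Reasoning
    h : Basis × Basis → W
    h p = scale (ε⊙ (η (proj₂ p))) (η (proj₁ p))
    f : List (Fin n) × List (Fin n) → Carrier
    f p = coeff _≟B_ (h (split n p)) x
    vanish : ∀ {p} → proj₂ p ≢ [] → f p ≈ 0#
    vanish {p} ne = coeff-scale-≈0 _≟B_ (η (n , proj₁ p)) x (ε⊙-η-nonempty n ne)

  Δ-ι : Δ⊙ (ι 1#) ≈W² (ι 1# ⊗ₑ ι 1#)
  Δ-ι = terms-↭⇒≈ _≟B2_ (unitCoeffs-Δ-η (0 , [])) (unitCoeffs-⊗ₑ (unitCoeffs-η (0 , [])) (unitCoeffs-η (0 , [])))
                  (↭-reflexive (terms-Δ-η 0 []))

  ε⊙-unitCoeffs : {xs : W} → UnitCoeffs xs → ε⊙ xs ≈ sum (map εB (terms xs))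
  ε⊙-unitCoeffs {[]}     []          = ≈-refl
  ε⊙-unitCoeffs {_ ∷ xs} (a≈1 ∷ one) = +-cong (≈-trans (*-cong a≈1 ≈-refl) (*-identityˡ _)) (ε⊙-unitCoeffs one)

  εB-nonempty : ∀ {n} {u : List (Fin n)} {k} → length u ≡ suc k → εB (n , u) ≈ 0#
  εB-nonempty {u = _ ∷ _} _ = ≈-refl

  ε-∇ : ∀ a b → ε⊙ (∇sh (η a ⊗ₑ η b)) ≈ ε⊙ (η a) * ε⊙ (η b)
  ε-∇ (m , v) (n , w) = ≈-trans (ε⊙-unitCoeffs (unitCoeffs-∇-η⊗η (m , v) (n , w)))
    (≈-trans (≈-reflexive (cong (sum ∘ map εB) (trans (terms-∇-η⊗η (m , v) (n , w)) (terms-mulB m v n w))))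
             (by-cases v w))
    where
    shuffles-nonempty : (v : List (Fin m)) (w : List (Fin n)) {k : ℕ} →
                        length (map (_↑ˡ n) v) ℕ.+ length (map (m ↑ʳ_) w) ≡ suc k →
                        sum (map εB (map (m ℕ.+ n ,_) (map (_↑ˡ n) v ⧢ map (m ↑ʳ_) w))) ≈ 0#
    shuffles-nonempty v w len = ≈-trans (≈-reflexive (cong sum (sym (map-∘ (map (_↑ˡ n) v ⧢ map (m ↑ʳ_) w)))))
      (sum-map-≈0 (εB ∘ (m ℕ.+ n ,_)) (All.map (λ {s} e → εB-nonempty {m ℕ.+ n} {s} (trans e len))
                                               (⧢-length (map (_↑ˡ n) v) (map (m ↑ʳ_) w))))
    by-cases : (v : List (Fin m)) (w : List (Fin n)) →
               sum (map εB (map (m ℕ.+ n ,_) (map (_↑ˡ n) v ⧢ map (m ↑ʳ_) w))) ≈ ε⊙ (η (m , v)) * ε⊙ (η (n , w))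
    by-cases []      []      = ≈-trans (+-identityʳ 1#)
      (≈-sym (≈-trans (*-cong (ε⊙-η-[] m) (ε⊙-η-[] n)) (*-identityˡ 1#)))
    by-cases (x ∷ v) w       = ≈-trans (shuffles-nonempty (x ∷ v) w refl)
      (≈-sym (≈-trans (*-cong (ε⊙-η-nonempty m {x ∷ v} (λ ())) ≈-refl) (zeroˡ _)))
    by-cases []      (y ∷ w) = ≈-trans (shuffles-nonempty [] (y ∷ w) refl)
      (≈-sym (≈-trans (*-cong ≈-refl (ε⊙-η-nonempty n {y ∷ w} (λ ()))) (zeroʳ _)))

  terms-Δ-∇ : ∀ m (v : List (Fin m)) n (w : List (Fin n)) →
              terms (Δ⊙ (∇sh (η (m , v) ⊗ₑ η (n , w))))
                ≡ map (split (m ℕ.+ n)) (concatMap deconcatenations (map (_↑ˡ n) v ⧢ map (m ↑ʳ_) w))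
  terms-Δ-∇ m v n w = begin
      terms (Δ⊙ (∇sh (η (m , v) ⊗ₑ η (n , w))))
    ≡⟨ terms-lin comulB (∇sh (η (m , v) ⊗ₑ η (n , w))) ⟩
      concatMap (terms ∘ comulB) (terms (∇sh (η (m , v) ⊗ₑ η (n , w))))
    ≡⟨ cong (concatMap (terms ∘ comulB)) (trans (terms-∇-η⊗η (m , v) (n , w)) (terms-mulB m v n w)) ⟩
      concatMap (terms ∘ comulB) (map (m ℕ.+ n ,_) S)
    ≡⟨ trans (concatMap-map (terms ∘ comulB) (m ℕ.+ n ,_) S) (concatMap-cong (terms-comulB (m ℕ.+ n)) S) ⟩
      concatMap (map (split (m ℕ.+ n)) ∘ deconcatenations) S
    ≡⟨ sym (map-concatMap (split (m ℕ.+ n)) deconcatenations S) ⟩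
      map (split (m ℕ.+ n)) (concatMap deconcatenations S) ∎
    where
    open ≡-Reasoning
    S = map (_↑ˡ n) v ⧢ map (m ↑ʳ_) w

  terms-∇⊗∇-Δ⊗Δ : ∀ m (v : List (Fin m)) n (w : List (Fin n)) →
                  terms ((∇sh ⊗ₘ ∇sh) (midSwap (Δ⊙ (η (m , v)) ⊗ₑ Δ⊙ (η (n , w)))))
                    ≡ map (split (m ℕ.+ n)) (shuffleOfDeconcatenations (map (_↑ˡ n) v) (map (m ↑ʳ_) w))
  terms-∇⊗∇-Δ⊗Δ m v n w = begin
      terms ((∇sh ⊗ₘ ∇sh) M)
    ≡⟨ terms-⊗ₘ ∇sh ∇sh M ⟩
      concatMap G (terms M)
    ≡⟨ cong (concatMap G) terms-M ⟩
      concatMap G (map μ (cartesianProduct (map (split m) dv) (map (split n) dw)))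
    ≡⟨ trans (concatMap-map G μ (cartesianProduct (map (split m) dv) (map (split n) dw)))
             (concatMap-cartesianProduct (G ∘ μ) (map (split m) dv) (map (split n) dw)) ⟩
      concatMap (λ a → concatMap (λ b → G (μ (a , b))) (map (split n) dw)) (map (split m) dv)
    ≡⟨ trans (concatMap-map _ (split m) dv)
             (concatMap-cong (λ p → trans (concatMap-map _ (split n) dw) (concatMap-cong (factor p) dw)) dv) ⟩
      concatMap (λ p → concatMap (λ q → map (split N) (L p ⧢₂ R q)) dw) dv
    ≡⟨ concatMap-cong inner dv ⟩
      concatMap (λ p → map (split N) (shuffleWithDeconcatenations (L p) (map (m ↑ʳ_) w))) dv
    ≡⟨ sym (map-concatMap (split N) _ dv) ⟩
      map (split N) (concatMap (λ p → shuffleWithDeconcatenations (L p) (map (m ↑ʳ_) w)) dv)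
    ≡⟨ cong (map (split N)) (trans (sym (concatMap-map _ L dv))
                                   (cong (concatMap _) (sym (deconcatenations-map (_↑ˡ n) v)))) ⟩
      map (split N) (shuffleOfDeconcatenations (map (_↑ˡ n) v) (map (m ↑ʳ_) w)) ∎
    where
    open ≡-Reasoning
    N = m ℕ.+ n
    dv = deconcatenations v
    dw = deconcatenations w
    L = Product.map (map (_↑ˡ n)) (map (_↑ˡ n))
    R = Product.map (map (m ↑ʳ_)) (map (m ↑ʳ_))
    M = midSwap (Δ⊙ (η (m , v)) ⊗ₑ Δ⊙ (η (n , w)))
    μ : (Basis × Basis) × (Basis × Basis) → (Basis × Basis) × (Basis × Basis)
    μ ((a , b) , (c , d)) = ((a , c) , (b , d))
    G : (Basis × Basis) × (Basis × Basis) → List (Basis × Basis)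
    G p = cartesianProduct (terms (∇sh (η (proj₁ p)))) (terms (∇sh (η (proj₂ p))))
    terms-M : terms M ≡ map μ (cartesianProduct (map (split m) dv) (map (split n) dw))
    terms-M = trans (map∘map-cong (λ _ → refl) (Δ⊙ (η (m , v)) ⊗ₑ Δ⊙ (η (n , w))))
      (cong (map μ) (trans (terms-⊗ₑ (Δ⊙ (η (m , v))) (Δ⊙ (η (n , w))))
                           (cong₂ cartesianProduct (terms-Δ-η m v) (terms-Δ-η n w))))
    factor : ∀ p q → G (μ (split m p , split n q)) ≡ map (split N) (L p ⧢₂ R q)
    factor (p₁ , p₂) (q₁ , q₂) =
      trans (cong₂ cartesianProduct (trans (terms-∇-η _) (terms-mulB m p₁ n q₁))
                                    (trans (terms-∇-η _) (terms-mulB m p₂ n q₂)))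
            (cartesianProduct-map (N ,_) (N ,_) (map (_↑ˡ n) p₁ ⧢ map (m ↑ʳ_) q₁)
                                                (map (_↑ˡ n) p₂ ⧢ map (m ↑ʳ_) q₂))
    inner : ∀ p → concatMap (λ q → map (split N) (L p ⧢₂ R q)) dw
                  ≡ map (split N) (shuffleWithDeconcatenations (L p) (map (m ↑ʳ_) w))
    inner p = trans (sym (map-concatMap (split N) (λ q → L p ⧢₂ R q) dw))
      (cong (map (split N)) (trans (sym (concatMap-map (L p ⧢₂_) R dw))
                                   (cong (concatMap (L p ⧢₂_)) (sym (deconcatenations-map (m ↑ʳ_) w)))))

  Δ-∇ : ∀ a b → Δ⊙ (∇sh (η a ⊗ₑ η b)) ≈W² (∇sh ⊗ₘ ∇sh) (midSwap (Δ⊙ (η a) ⊗ₑ Δ⊙ (η b)))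
  Δ-∇ (m , v) (n , w) = terms-↭⇒≈ _≟B2_
    (unitCoeffs-Δ (unitCoeffs-∇-η⊗η (m , v) (n , w)))
    (unitCoeffs-⊗ₘ ∇sh ∇sh (λ p → unitCoeffs-∇ (unitCoeffs-η p)) (λ p → unitCoeffs-∇ (unitCoeffs-η p))
                   (All-map⁺ (unitCoeffs-⊗ₑ (unitCoeffs-Δ-η (m , v)) (unitCoeffs-Δ-η (n , w)))))
    (↭-trans (↭-reflexive (terms-Δ-∇ m v n w))
             (↭-trans (map⁺-↭ (split (m ℕ.+ n)) (deconcatenations-⧢ (map (_↑ˡ n) v) (map (m ↑ʳ_) w)))
                      (↭-reflexive (sym (terms-∇⊗∇-Δ⊗Δ m v n w)))))

  ∇-graded : ∀ a b u → ¬ (deg u ≡ deg a ℕ.+ deg b) → coeff _≟B_ (∇sh (η a ⊗ₑ η b)) u ≈ 0#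
  ∇-graded (m , v) (n , w) u ne = coeff-∉ _≟B_ (∇sh (η (m , v) ⊗ₑ η (n , w)))
    (subst (All (_≢ u)) (sym (trans (terms-∇-η⊗η (m , v) (n , w)) (terms-mulB m v n w)))
      (All-map⁺ (All.map (λ e eq → ne (trans (sym (cong deg eq)) (trans e (cong₂ ℕ._+_ (length-map _ v) (length-map _ w)))))
                         (⧢-length (map (_↑ˡ n) v) (map (m ↑ʳ_) w)))))

  ι-graded : ∀ u → ¬ (deg u ≡ 0) → coeff _≟B_ (ι 1#) u ≈ 0#
  ι-graded u ne = coeff-∉ _≟B_ (ι 1#) {u} ((λ eq → ne (sym (cong deg eq))) ∷ [])

  Δ-graded : ∀ a u v → ¬ (deg u ℕ.+ deg v ≡ deg a) → coeff _≟B2_ (Δ⊙ (η a)) (u , v) ≈ 0#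
  Δ-graded (n , w) u v ne = coeff-∉ _≟B2_ (Δ⊙ (η (n , w)))
    (subst (All (_≢ (u , v))) (sym (terms-Δ-η n w))
      (All-map⁺ (All.map (λ e eq → ne (trans (sym (cong (λ t → deg (proj₁ t) ℕ.+ deg (proj₂ t)) eq)) e))
                         (deconcatenations-length w))))

  ε-graded : ∀ a → ¬ (deg a ≡ 0) → ε⊙ (η a) ≈ 0#
  ε-graded (n , [])    ne = ⊥-elim (ne refl)
  ε-graded (n , x ∷ w) _  = ε⊙-η-nonempty n {x ∷ w} (λ ())

  isGradedBialgebra : IsGradedBialgebra
  isGradedBialgebra = record
    { assoc    = ∇-assoc
    ; unitˡ    = ∇-unitˡ
    ; unitʳ    = ∇-unitʳ
    ; coassoc  = Δ-coassoc
    ; counitˡ  = ε-counitˡ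
    ; counitʳ  = ε-counitʳ
    ; Δ-∇      = Δ-∇
    ; Δ-ι      = Δ-ι
    ; ε-∇      = ε-∇
    ; ε-ι      = ε⊙-η-[] 0
    ; ∇-graded = ∇-graded
    ; ι-graded = ι-graded
    ; Δ-graded = Δ-graded
    ; ε-graded = ε-graded
    }

  coeff-ι-[] : ∀ a → coeff _≟B_ (ι a) (0 , []) ≈ a
  coeff-ι-[] a with (0 , []) ≟B (0 , [])
  ... | yes _ = +-identityʳ a
  ... | no ne = ⊥-elim (ne refl)

  terms-mulB-[∅,1] : ∀ a → All (_≢ (0 , [])) (terms (mulB a (1 , [])))
  terms-mulB-[∅,1] (k , u) = subst (All (_≢ (0 , []))) (sym (terms-mulB k u 1 []))
    (All-map⁺ (All.universal (λ s eq → ℕ.1+n≢0 (trans (sym (ℕ.+-suc k 0)) (cong proj₁ eq))) _))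

  ¬antipode : ∀ S → ¬ IsAntipode S
  ¬antipode S (∇[S⊗id]Δ≈ιε , _) = 1≉0 (begin
      1#                                         ≈⟨ ≈-sym (ε⊙-η-[] 1) ⟩
      ε⊙ (η (1 , []))                            ≈⟨ ≈-sym (coeff-ι-[] _) ⟩
      coeff _≟B_ (ι (ε⊙ (η (1 , [])))) (0 , [])  ≈⟨ ≈-sym (∇[S⊗id]Δ≈ιε (1 , []) (0 , [])) ⟩
      coeff _≟B_ (∇sh Z) (0 , [])                ≈⟨ coeff-∉ _≟B_ (∇sh Z) misses ⟩
      0#                                         ∎)
    where
    open ≈-Reasoning
    Z = (lin S ⊗ₘ idₘ) (Δ⊙ (η (1 , [])))
    G : Basis × Basis → List (Basis × Basis)
    G p = cartesianProduct (terms (lin S (η (proj₁ p)))) [ proj₂ p ]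
    right-factor : All (λ p → proj₂ p ≡ (1 , [])) (terms Z)
    right-factor = subst (All (λ p → proj₂ p ≡ (1 , [])))
      (sym (trans (terms-⊗ₘ (lin S) idₘ (Δ⊙ (η (1 , [])))) (cong (concatMap G) (terms-Δ-η 1 []))))
      (All-++⁺ (subst (All (λ p → proj₂ p ≡ (1 , [])))
                      (sym (cartesianProduct-singletonʳ (terms (lin S (η (1 , [])))) (1 , [])))
                      (All-map⁺ (All.universal (λ _ → refl) (terms (lin S (η (1 , [])))))))
               [])
    misses : All (_≢ (0 , [])) (terms (∇sh Z))
    misses = subst (All (_≢ (0 , []))) (sym (terms-lin mulB′ Z))
      (All-concat⁺ (All-map⁺ (All.map (λ {p} eq → subst (λ b → All (_≢ (0 , [])) (terms (mulB (proj₁ p) b)))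
                                                          (sym eq) (terms-mulB-[∅,1] (proj₁ p)))
                                      right-factor)))

  ¬isHopfAlgebra : ¬ IsHopfAlgebra
  ¬isHopfAlgebra (_ , S , antipode) = ¬antipode S antipode

theorem3p5 : ∀ {c ℓ} (F : Field c ℓ) →
    WordAlgebra.IsGradedBialgebra F × ¬ WordAlgebra.IsHopfAlgebra F
theorem3p5 F = isGradedBialgebra , ¬isHopfAlgebra
  where open WordBialgebraLaws F
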